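{- For each $1 \le k \le n$, the map $f_n$ is a bijection from $Bl_{n,k}$ onto $L_{n,n-k}$ which preserves the set of left-to-right maxima, i.e., $\mathrm{Ltr}(f_n(\pi))=\mathrm{Ltr}(\pi)$.
   Context: $\S_n(321)$ is the set of $321$-avoiding permutations in $\S_n$. $\mathrm{Ltr}(\pi)=\{i:\pi(i)=\max\{\pi(1),\dots,\pi(i)\}\}$; $\mathrm{ldes}(\pi)$ is the largest $i$ with $\pi(i)>\pi(i+1)$ ($0$ if none); $\mathrm{bl}(\pi)=|\{i : \pi(j)\le i \text{ for all } j\le i\}|$ is the block number. $Bl_{n,k}=\{\pi\in\S_n(321):\mathrm{bl}(\pi)=k\}$ and $L_{n,k}=\{\pi\in\S_n(321):\mathrm{ldes}(\pi^{ -1})=k\}$. Maps $f_n:\S_n(321)\to\S_n(321)$ are defined recursively: $f_1$ is the identity on $\S_1$. For $\pi\in\S_n(321)$, $n\ge2$, let $k=\mathrm{bl}(\pi)$. Case A: $\pi^{ -1}(n)=n$: delete $n$, apply $f_{n-1}$, and insert $n$ at the last position. Case B: $\pi^{ -1}(n-1)<\pi^{ -1}(n)<n$: delete $n$, apply $f_{n-1}$, insert $n$ at the same position as in $\pi$, and multiply on the left by the transposition $(n-k-1,n-k)$. Case C: $\pi^{ -1}(n)<\pi^{ -1}(n-1)$ (so $n-1$ is the last letter): let $\pi'=(n-1,n)\pi$, compute $f_n(\pi')$ as in case A, and multiply it on the left by the cycle $(n-k,n-k+1,\dots,n)$. (Left multiplication by a permutation acts on the values/letters.) -}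

module Defs where

open import Data.Nat using (ℕ; zero; suc; _+_; _∸_; _⊔_; _<_; _≤ᵇ_; _<ᵇ_; _≡ᵇ_)
open import Data.Bool using (Bool; true; false; if_then_else_; _∧_)
open import Data.List using (List; []; _∷_; _++_; [_]; map; upTo; length; take; drop;  filterᵇ; foldr; lookup)
open import Data.List.Relation.Binary.Permutation.Propositional using (_↭_)
open import Data.Fin as Fin using (Fin)
open import Data.Product using (_×_)
open import Relation.Binary.PropositionalEquality using (_≡_)
open import Relation.Nullary using (¬_)

-- Permutations of [n] = {1,…,n} in one-line notation: the list [π(1), …, π(n)].
-- Positions are 1-based everywhere below.

range : ℕ → List ℕ
range n = map suc (upTo n)

IsPerm : ℕ → List ℕ → Set
IsPerm n π = π ↭ range n

Avoids321 : List ℕ → Set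
Avoids321 π = (i j l : Fin (length π)) → i Fin.< j → j Fin.< l →
  ¬ (lookup π j < lookup π i × lookup π l < lookup π j)

S321 : ℕ → List ℕ → Set
S321 n π = IsPerm n π × Avoids321 π

-- 0-based index of the first occurrence of v in l (length l if absent)
pos : ℕ → List ℕ → ℕ
pos v [] = zero
pos v (x ∷ l) = if x ≡ᵇ v then zero else suc (pos v l)

inverse : ℕ → List ℕ → List ℕ
inverse n π = map (λ v → suc (pos v π)) (range n)

-- Ltr(π) = {i : π(i) = max{π(1),…,π(i)}}, listed increasingly
ltrAux : ℕ → ℕ → List ℕ → List ℕ
ltrAux i m [] = []
ltrAux i m (x ∷ r) = if m ≤ᵇ x then i ∷ ltrAux (suc i) x r else ltrAux (suc i) m r

Ltr : List ℕ → List ℕ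
Ltr π = ltrAux 1 0 π

descAux : ℕ → List ℕ → List ℕ
descAux i [] = []
descAux i (x ∷ []) = []
descAux i (x ∷ y ∷ r) = (if y <ᵇ x then i ∷ [] else []) ++ descAux (suc i) (y ∷ r)

-- ldes(π) = largest descent position, 0 if none
ldes : List ℕ → ℕ
ldes π = foldr _⊔_ 0 (descAux 1 π)

allᵇ : (ℕ → Bool) → List ℕ → Bool
allᵇ p [] = true
allᵇ p (x ∷ l) = p x ∧ allᵇ p l

bl : List ℕ → ℕ
bl π = length (filterᵇ (λ i → allᵇ (λ x → x ≤ᵇ i) (take i π)) (range (length π)))

remove : ℕ → List ℕ → List ℕ
remove v = filterᵇ (λ x → if x ≡ᵇ v then false else true)

-- insert letter v so that it sits at 0-based index p
insertAt : ℕ → ℕ → List ℕ → List ℕ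
insertAt p v l = take p l ++ v ∷ drop p l

-- left multiplication by the transposition (a,b): acts on letters
transpVal : ℕ → ℕ → ℕ → ℕ
transpVal a b x = if x ≡ᵇ a then b else (if x ≡ᵇ b then a else x)

transp : ℕ → ℕ → List ℕ → List ℕ
transp a b = map (transpVal a b)

-- left multiplication by the cycle (a, a+1, …, b): a↦a+1, …, b-1↦b, b↦a
cycVal : ℕ → ℕ → ℕ → ℕ
cycVal a b x = if (a ≤ᵇ x) ∧ (x <ᵇ b) then suc x else (if x ≡ᵇ b then a else x)

cyc : ℕ → ℕ → List ℕ → List ℕ
cyc a b = map (cycVal a b)

-- one recursion step of f_n for n = m+2, given g = f_{n-1}
fStep : ℕ → (List ℕ → List ℕ) → List ℕ → List ℕ
fStep m g π =
  if p ≡ᵇ suc m then caseA π                      -- case A: π⁻¹(n) = n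
  else (if q <ᵇ p then caseB                        -- case B: π⁻¹(n-1) < π⁻¹(n) < n
  else cyc (n ∸ k) n (caseA (transp (suc m) n π)))  -- case C: π⁻¹(n) < π⁻¹(n-1)
  where
    n = suc (suc m)
    k = bl π
    p = pos n π
    q = pos (suc m) π
    caseA : List ℕ → List ℕ
    caseA σ = g (remove n σ) ++ [ n ]
    caseB = transp (n ∸ k ∸ 1) (n ∸ k) (insertAt p n (g (remove n π)))

f : ℕ → List ℕ → List ℕ
f zero π = π
f (suc zero) π = π
f (suc (suc m)) π = fStep m (f (suc m)) π

Bl : ℕ → ℕ → List ℕ → Set
Bl n k π = S321 n π × bl π ≡ k

L : ℕ → ℕ → List ℕ → Set
L n k π = S321 n π × ldes (inverse n π) ≡ k

module Submission where

-- Everything is read off one left-to-right scan of a word: its left-to-right maxima and its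
-- last letter that is not a maximum. A word avoids 321 exactly when its non-maxima increase;
-- then ldes(τ⁻¹) is the last non-maximum of τ, and bl(π) counts the positions i whose prefix
-- maximum is i.
--
-- Removing n from π ∈ Bl_{n,k} (in case C after exchanging n and n - 1) leaves a
-- permutation in Bl_{n-1,k-1} in case A and in Bl_{n-1,k} in cases B and C, to which
-- induction applies. Appending n (case A), inserting n back and swapping c = n - 1 - k with
-- c + 1 (case B), or applying the cycle (n - k, …, n) (case C) makes the last non-maximum
-- equal to n - k and keeps the left-to-right maxima. The image ends with n in case A, and
-- with n - k in cases B and C, where the last non-maximum before it is below, resp. equal
-- to, n - k - 1; so the cases can be told apart on the image, which gives injectivity, and
-- every τ ∈ L_{n,n-k} falls into one of them, which gives surjectivity.

open import Defs
open import Data.Nat using (ℕ; _≤_; _∸_)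
open import Data.List using (List)
open import Data.Product using (_×_; Σ)
open import Relation.Binary.PropositionalEquality using (_≡_)

open import Data.Bool using (Bool; true; false; if_then_else_; _∧_; T)
open import Data.Bool.Properties using (if-cong)
open import Data.Empty using (⊥; ⊥-elim)
open import Data.Fin as Fin using (Fin)
open import Data.List using ([]; _∷_; _++_; [_]; _∷ʳ_; map; length; take; drop; lookup; foldr; foldl; replicate; applyUpTo; filterᵇ; initLast; _∷ʳ′_)
open import Data.List.Membership.Propositional using (_∈_; _∉_)
open import Data.List.Membership.Propositional.Properties using (∈-∃++; ∈-++⁺ˡ; ∈-++⁺ʳ; ∈-++⁻; ∈-map⁺)
open import Data.List.Properties
open import Data.List.Relation.Binary.Permutation.Propositional using (_↭_; ↭-sym; ↭-trans; ↭-refl; ↭-reflexive; prep; swap)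
open import Data.List.Relation.Binary.Permutation.Propositional.Properties using (∈-resp-↭; ↭-length; shift; drop-∷; map⁺; ++⁺)
open import Data.List.Relation.Unary.All as All using (All; []; _∷_)
open import Data.List.Relation.Unary.All.Properties using (++⁻ˡ) renaming (++⁺ to All-++⁺)
open import Data.List.Relation.Unary.Any using (here; there)
open import Data.Nat using (zero; suc; pred; s≤s⁻¹; _+_; _⊔_; _<_; _≤ᵇ_; _<ᵇ_; _≡ᵇ_; z≤n; s≤s)
open import Data.Nat.Properties
open import Data.Product using (_,_; proj₁; proj₂; ∃; ∃₂)
open import Data.Sum as Sum using (_⊎_; inj₁; inj₂)
open import Data.Unit using (⊤; tt)
open import Function using (_∘_; id)
open import Relation.Binary.Definitions using (tri<; tri≈; tri>)
open import Relation.Binary.PropositionalEquality using (refl; sym; trans; cong; cong₂; subst; subst₂; _≢_; module ≡-Reasoning)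
open import Relation.Nullary using (¬_; Dec; yes; no)
open import Relation.Nullary.Reflects using (Reflects; ofʸ; ofⁿ; fromEquivalence; det)

data ≤ᵇ-View (m x : ℕ) : Bool → Set where
  is≤ : m ≤ x → ≤ᵇ-View m x true
  is> : x < m → ≤ᵇ-View m x false

≤ᵇ-view : ∀ m x → ≤ᵇ-View m x (m ≤ᵇ x)
≤ᵇ-view m x with m ≤ᵇ x | ≤ᵇ-reflects-≤ m x
... | true  | ofʸ m≤x = is≤ m≤x
... | false | ofⁿ m≰x = is> (≰⇒> m≰x)

≡ᵇ-reflects-≡ : ∀ m n → Reflects (m ≡ n) (m ≡ᵇ n)
≡ᵇ-reflects-≡ m n = fromEquivalence (≡ᵇ⇒≡ m n) (≡⇒≡ᵇ m n)

∷-view : ∀ (l : List ℕ) {r} → length l ≡ suc r → ∃₂ λ y l′ → l ≡ y ∷ l′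
∷-view (y ∷ l′) _ = y , l′ , refl

∷ʳ-view : ∀ (l : List ℕ) {r} → length l ≡ suc r → ∃₂ λ Z c → l ≡ Z ∷ʳ c
∷ʳ-view l eq with initLast l | eq
... | Z ∷ʳ′ c | _ = Z , c , refl

length-∷ʳ : ∀ (P : List ℕ) x → length (P ∷ʳ x) ≡ suc (length P)
length-∷ʳ P x = trans (length-++ P) (+-comm (length P) 1)

∈-take : ∀ {x : ℕ} {i l} → x ∈ take i l → x ∈ l
∈-take {i = suc i} {y ∷ l} (here refl) = here refl
∈-take {i = suc i} {y ∷ l} (there x∈) = there (∈-take x∈)

insertAt-length : ∀ (X W : List ℕ) v → insertAt (length X) v (X ++ W) ≡ X ++ v ∷ W
insertAt-length [] W v = refl
insertAt-length (x ∷ X) W v = cong (x ∷_) (insertAt-length X W v)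

++-cancel-≡length : ∀ {A : Set} (P Q P′ Q′ : List A) → P ++ Q ≡ P′ ++ Q′ → length P ≡ length P′ → P ≡ P′ × Q ≡ Q′
++-cancel-≡length [] Q [] Q′ eq _ = refl , eq
++-cancel-≡length (x ∷ P) Q (y ∷ P′) Q′ eq len with ∷-injective eq
... | refl , eq′ with ++-cancel-≡length P Q P′ Q′ eq′ (suc-injective len)
...   | refl , refl = refl , refl

insert-injective : ∀ {v : ℕ} X₁ {Y₁} X₂ {Y₂} → v ∉ X₁ → v ∉ X₂ → X₁ ++ v ∷ Y₁ ≡ X₂ ++ v ∷ Y₂ → X₁ ≡ X₂ × Y₁ ≡ Y₂
insert-injective [] [] _ _ eq = refl , ∷-injectiveʳ eq
insert-injective [] (x ∷ X₂) _ v∉X₂ eq = ⊥-elim (v∉X₂ (here (∷-injectiveˡ eq)))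
insert-injective (x ∷ X₁) [] v∉X₁ _ eq = ⊥-elim (v∉X₁ (here (sym (∷-injectiveˡ eq))))
insert-injective (x ∷ X₁) (y ∷ X₂) v∉X₁ v∉X₂ eq with ∷-injective eq
... | refl , eq′ with insert-injective X₁ X₂ (v∉X₁ ∘ there) (v∉X₂ ∘ there) eq′
...   | refl , refl = refl , refl

map-inverse : ∀ {g h : ℕ → ℕ} → (∀ x → g (h x) ≡ x) → ∀ l → map g (map h l) ≡ l
map-inverse inv l = trans (sym (map-∘ l)) (map-id-local (All.universal inv l))

map-injective-inverse : ∀ {g h : ℕ → ℕ} → (∀ x → h (g x) ≡ x) → ∀ {l l′} → map g l ≡ map g l′ → l ≡ l′
map-injective-inverse {g} {h} inv = map-injective λ {x} {y} gx≡gy → trans (sym (inv x)) (trans (cong h gx≡gy) (inv y))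

Distinct : List ℕ → Set
Distinct [] = ⊤
Distinct (x ∷ l) = x ∉ l × Distinct l

Distinct-resp-↭ : ∀ {l l′} → l ↭ l′ → Distinct l → Distinct l′
Distinct-resp-↭ _↭_.refl d = d
Distinct-resp-↭ (prep x p) (x∉ , d) = (x∉ ∘ ∈-resp-↭ (↭-sym p)) , Distinct-resp-↭ p d
Distinct-resp-↭ (swap x y p) (x∉ , y∉ , d) =
  (λ { (here refl) → x∉ (here refl) ; (there y∈) → y∉ (∈-resp-↭ (↭-sym p) y∈) }) ,
  (x∉ ∘ there ∘ ∈-resp-↭ (↭-sym p)) , Distinct-resp-↭ p d
Distinct-resp-↭ (_↭_.trans p q) d = Distinct-resp-↭ q (Distinct-resp-↭ p d)

Distinct-++⁻ : ∀ A B → Distinct (A ++ B) → Distinct A × Distinct B × (∀ {y} → y ∈ A → y ∉ B)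
Distinct-++⁻ [] B d = tt , d , λ ()
Distinct-++⁻ (a ∷ A) B (a∉ , d) with Distinct-++⁻ A B d
... | dA , dB , disjoint = ((a∉ ∘ ∈-++⁺ˡ) , dA) , dB ,
      λ { (here refl) y∈B → a∉ (∈-++⁺ʳ A y∈B) ; (there y∈A) → disjoint y∈A }

Distinct-mid⁻ : ∀ A x B → Distinct (A ++ x ∷ B) → x ∉ A × x ∉ B × Distinct (A ++ B)
Distinct-mid⁻ [] x B (x∉ , d) = (λ ()) , x∉ , d
Distinct-mid⁻ (a ∷ A) x B (a∉ , d) with Distinct-mid⁻ A x B d
... | x∉A , x∉B , d′ = (λ { (here refl) → a∉ (∈-++⁺ʳ A (here refl)) ; (there x∈A) → x∉A x∈A }) , x∉B ,
      (a∉ ∘ skip) , d′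
  where skip : ∀ {y} → y ∈ A ++ B → y ∈ A ++ x ∷ B
        skip y∈ = Sum.[ ∈-++⁺ˡ , ∈-++⁺ʳ A ∘ there ] (∈-++⁻ A y∈)

-- Scanning a word from left to right

-- A left-to-right scan of a word: m is the running maximum and u the last
-- letter read that was not a left-to-right maximum.
ltrMask : ℕ → List ℕ → List Bool
ltrMask m [] = []
ltrMask m (x ∷ l) = if m ≤ᵇ x then true ∷ ltrMask x l else false ∷ ltrMask m l

scanMax : ℕ → List ℕ → ℕ
scanMax m [] = m
scanMax m (x ∷ l) = if m ≤ᵇ x then scanMax x l else scanMax m l

lastNonMax : ℕ → ℕ → List ℕ → ℕ
lastNonMax m u [] = u
lastNonMax m u (x ∷ l) = if m ≤ᵇ x then lastNonMax x u l else lastNonMax m x l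

-- A word avoids 321 iff its letters that are not left-to-right maxima increase.
Avoids321From : ℕ → ℕ → List ℕ → Set
Avoids321From m u [] = ⊤
Avoids321From m u (x ∷ l) = if m ≤ᵇ x then Avoids321From x u l else (u ≤ x × Avoids321From m x l)

ltrMask-++ : ∀ m X Y → ltrMask m (X ++ Y) ≡ ltrMask m X ++ ltrMask (scanMax m X) Y
ltrMask-++ m [] Y = refl
ltrMask-++ m (x ∷ X) Y with m ≤ᵇ x
... | true  = cong (true ∷_) (ltrMask-++ x X Y)
... | false = cong (false ∷_) (ltrMask-++ m X Y)

scanMax-++ : ∀ m X Y → scanMax m (X ++ Y) ≡ scanMax (scanMax m X) Y
scanMax-++ m [] Y = refl
scanMax-++ m (x ∷ X) Y with m ≤ᵇ x
... | true  = scanMax-++ x X Y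
... | false = scanMax-++ m X Y

lastNonMax-++ : ∀ m u X Y → lastNonMax m u (X ++ Y) ≡ lastNonMax (scanMax m X) (lastNonMax m u X) Y
lastNonMax-++ m u [] Y = refl
lastNonMax-++ m u (x ∷ X) Y with m ≤ᵇ x
... | true  = lastNonMax-++ x u X Y
... | false = lastNonMax-++ m x X Y

Avoids321From-++⁻ : ∀ m u X Y → Avoids321From m u (X ++ Y) →
  Avoids321From m u X × Avoids321From (scanMax m X) (lastNonMax m u X) Y
Avoids321From-++⁻ m u [] Y a = tt , a
Avoids321From-++⁻ m u (x ∷ X) Y a with m ≤ᵇ x
... | true  = Avoids321From-++⁻ x u X Y a
... | false = (proj₁ a , proj₁ rest) , proj₂ rest
  where rest = Avoids321From-++⁻ m x X Y (proj₂ a)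

Avoids321From-++⁺ : ∀ m u X Y → Avoids321From m u X →
  Avoids321From (scanMax m X) (lastNonMax m u X) Y → Avoids321From m u (X ++ Y)
Avoids321From-++⁺ m u [] Y _ b = b
Avoids321From-++⁺ m u (x ∷ X) Y a b with m ≤ᵇ x
... | true  = Avoids321From-++⁺ x u X Y a b
... | false = proj₁ a , Avoids321From-++⁺ m x X Y (proj₂ a) b

module _ {m x : ℕ} (Y : List ℕ) where

  private
    ≤ᵇ-true : m ≤ x → (m ≤ᵇ x) ≡ true
    ≤ᵇ-true m≤x = det (≤ᵇ-reflects-≤ m x) (ofʸ m≤x)

    ≤ᵇ-false : x < m → (m ≤ᵇ x) ≡ false
    ≤ᵇ-false x<m = det (≤ᵇ-reflects-≤ m x) (ofⁿ (<⇒≱ x<m))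

  ltrMask-max : m ≤ x → ltrMask m (x ∷ Y) ≡ true ∷ ltrMask x Y
  ltrMask-max m≤x rewrite ≤ᵇ-true m≤x = refl

  lastNonMax-max : ∀ {u} → m ≤ x → lastNonMax m u (x ∷ Y) ≡ lastNonMax x u Y
  lastNonMax-max m≤x rewrite ≤ᵇ-true m≤x = refl

  Avoids321From-max : ∀ {u} → m ≤ x → Avoids321From m u (x ∷ Y) ≡ Avoids321From x u Y
  Avoids321From-max m≤x rewrite ≤ᵇ-true m≤x = refl

  ltrMask-nonMax : x < m → ltrMask m (x ∷ Y) ≡ false ∷ ltrMask m Y
  ltrMask-nonMax x<m rewrite ≤ᵇ-false x<m = refl

  lastNonMax-nonMax : ∀ {u} → x < m → lastNonMax m u (x ∷ Y) ≡ lastNonMax m x Y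
  lastNonMax-nonMax x<m rewrite ≤ᵇ-false x<m = refl

  Avoids321From-nonMax : ∀ {u} → x < m → Avoids321From m u (x ∷ Y) ≡ (u ≤ x × Avoids321From m x Y)
  Avoids321From-nonMax x<m rewrite ≤ᵇ-false x<m = refl

scanMax-≥ : ∀ m l → m ≤ scanMax m l
scanMax-≥ m [] = ≤-refl
scanMax-≥ m (x ∷ l) with m ≤ᵇ x | ≤ᵇ-view m x
... | true  | is≤ m≤x = ≤-trans m≤x (scanMax-≥ x l)
... | false | is> _   = scanMax-≥ m l

∈⇒≤scanMax : ∀ m l {y} → y ∈ l → y ≤ scanMax m l
∈⇒≤scanMax m (x ∷ l) (here refl) with m ≤ᵇ x | ≤ᵇ-view m x
... | true  | is≤ _   = scanMax-≥ x l
... | false | is> x<m = ≤-trans (<⇒≤ x<m) (scanMax-≥ m l)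
∈⇒≤scanMax m (x ∷ l) (there y∈l) with m ≤ᵇ x
... | true  = ∈⇒≤scanMax x l y∈l
... | false = ∈⇒≤scanMax m l y∈l

scanMax-lub : ∀ m l {b} → m ≤ b → All (_≤ b) l → scanMax m l ≤ b
scanMax-lub m [] m≤b _ = m≤b
scanMax-lub m (x ∷ l) m≤b (x≤b ∷ l≤b) with m ≤ᵇ x
... | true  = scanMax-lub x l x≤b l≤b
... | false = scanMax-lub m l m≤b l≤b

lastNonMax-≥ : ∀ m u l → Avoids321From m u l → u ≤ lastNonMax m u l
lastNonMax-≥ m u [] _ = ≤-refl
lastNonMax-≥ m u (x ∷ l) a with m ≤ᵇ x
... | true  = lastNonMax-≥ x u l a
... | false = ≤-trans (proj₁ a) (lastNonMax-≥ m x l (proj₂ a))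

-- Letters below the running maximum are non-maxima, and these increase.
<max⇒≤lastNonMax : ∀ m u l {y} → Avoids321From m u l → y ∈ l → y < m → y ≤ lastNonMax m u l
<max⇒≤lastNonMax m u (x ∷ l) a (here refl) y<m with m ≤ᵇ x | ≤ᵇ-view m x
... | true  | is≤ m≤y = ⊥-elim (<⇒≱ y<m m≤y)
... | false | is> _   = lastNonMax-≥ m x l (proj₂ a)
<max⇒≤lastNonMax m u (x ∷ l) a (there y∈l) y<m with m ≤ᵇ x | ≤ᵇ-view m x
... | true  | is≤ m≤x = <max⇒≤lastNonMax x u l a y∈l (<-≤-trans y<m m≤x)
... | false | is> _   = <max⇒≤lastNonMax m x l (proj₂ a) y∈l y<m

lastNonMax-initial⊎∈ : ∀ m u l → lastNonMax m u l ≡ u ⊎ (lastNonMax m u l ∈ l × lastNonMax m u l < scanMax m l)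
lastNonMax-initial⊎∈ m u [] = inj₁ refl
lastNonMax-initial⊎∈ m u (x ∷ l) with m ≤ᵇ x | ≤ᵇ-view m x
... | true | is≤ _ with lastNonMax-initial⊎∈ x u l
...   | inj₁ eq           = inj₁ eq
...   | inj₂ (∈l , <max) = inj₂ (there ∈l , <max)
lastNonMax-initial⊎∈ m u (x ∷ l) | false | is> x<m with lastNonMax-initial⊎∈ m x l
...   | inj₁ eq           = inj₂ (subst (_∈ x ∷ l) (sym eq) (here refl) , subst (_< scanMax m l) (sym eq) (<-≤-trans x<m (scanMax-≥ m l)))
...   | inj₂ (∈l , <max) = inj₂ (there ∈l , <max)

length-ltrMask : ∀ m l → length (ltrMask m l) ≡ length l
length-ltrMask m [] = refl
length-ltrMask m (x ∷ l) with m ≤ᵇ x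
... | true  = cong suc (length-ltrMask x l)
... | false = cong suc (length-ltrMask m l)

trueIndices : ℕ → List Bool → List ℕ
trueIndices i [] = []
trueIndices i (true ∷ b) = i ∷ trueIndices (suc i) b
trueIndices i (false ∷ b) = trueIndices (suc i) b

ltrAux≡trueIndices : ∀ i m l → ltrAux i m l ≡ trueIndices i (ltrMask m l)
ltrAux≡trueIndices i m [] = refl
ltrAux≡trueIndices i m (x ∷ l) with m ≤ᵇ x
... | true  = cong (i ∷_) (ltrAux≡trueIndices (suc i) x l)
... | false = ltrAux≡trueIndices (suc i) m l

Ltr-cong : ∀ π σ → ltrMask 0 π ≡ ltrMask 0 σ → Ltr π ≡ Ltr σ
Ltr-cong π σ eq = begin
  Ltr π                         ≡⟨ ltrAux≡trueIndices 1 0 π ⟩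
  trueIndices 1 (ltrMask 0 π)   ≡⟨ cong (trueIndices 1) eq ⟩
  trueIndices 1 (ltrMask 0 σ)   ≡⟨ ltrAux≡trueIndices 1 0 σ ⟨
  Ltr σ                         ∎
  where open ≡-Reasoning

-- l can follow a prefix with maximum m and last non-maximum u without creating a 321.
Avoids321After : ℕ → ℕ → List ℕ → Set
Avoids321After m u l =
  ((k : Fin (length l)) → ¬ (lookup l k < u))
  × ((j k : Fin (length l)) → j Fin.< k → ¬ (lookup l k < lookup l j × lookup l j < m))
  × Avoids321 l

Avoids321From⇒After : ∀ m u l → u ≤ m → Avoids321From m u l → Avoids321After m u l
Avoids321From⇒After m u [] _ _ = (λ ()) , (λ ()) , λ ()
Avoids321From⇒After m u (x ∷ l) u≤m a with m ≤ᵇ x | ≤ᵇ-view m x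
... | true | is≤ m≤x = noneBelow , noInversion , avoids
  where
    ih = Avoids321From⇒After x u l (≤-trans u≤m m≤x) a
    noneBelow : (k : Fin (length (x ∷ l))) → ¬ (lookup (x ∷ l) k < u)
    noneBelow Fin.zero x<u = <⇒≱ x<u (≤-trans u≤m m≤x)
    noneBelow (Fin.suc k) = proj₁ ih k
    noInversion : (j k : Fin (length (x ∷ l))) → j Fin.< k →
      ¬ (lookup (x ∷ l) k < lookup (x ∷ l) j × lookup (x ∷ l) j < m)
    noInversion Fin.zero k _ (_ , x<m) = <⇒≱ x<m m≤x
    noInversion (Fin.suc j) (Fin.suc k) j<k (lk<lj , lj<m) =
      proj₁ (proj₂ ih) j k (s≤s⁻¹ j<k) (lk<lj , <-≤-trans lj<m m≤x)
    avoids : Avoids321 (x ∷ l)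
    avoids Fin.zero (Fin.suc j) (Fin.suc k) _ j<k (lj<x , lk<lj) = proj₁ (proj₂ ih) j k (s≤s⁻¹ j<k) (lk<lj , lj<x)
    avoids (Fin.suc i) (Fin.suc j) (Fin.suc k) i<j j<k = proj₂ (proj₂ ih) i j k (s≤s⁻¹ i<j) (s≤s⁻¹ j<k)
... | false | is> x<m = noneBelow , noInversion , avoids
  where
    ih = Avoids321From⇒After m x l (<⇒≤ x<m) (proj₂ a)
    noneBelow : (k : Fin (length (x ∷ l))) → ¬ (lookup (x ∷ l) k < u)
    noneBelow Fin.zero x<u = <⇒≱ x<u (proj₁ a)
    noneBelow (Fin.suc k) lk<u = proj₁ ih k (<-≤-trans lk<u (proj₁ a))
    noInversion : (j k : Fin (length (x ∷ l))) → j Fin.< k →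
      ¬ (lookup (x ∷ l) k < lookup (x ∷ l) j × lookup (x ∷ l) j < m)
    noInversion Fin.zero (Fin.suc k) _ (lk<x , _) = proj₁ ih k lk<x
    noInversion (Fin.suc j) (Fin.suc k) j<k = proj₁ (proj₂ ih) j k (s≤s⁻¹ j<k)
    avoids : Avoids321 (x ∷ l)
    avoids Fin.zero (Fin.suc j) (Fin.suc k) _ j<k (lj<x , lk<lj) =
      proj₁ (proj₂ ih) j k (s≤s⁻¹ j<k) (lk<lj , <-trans lj<x x<m)
    avoids (Fin.suc i) (Fin.suc j) (Fin.suc k) i<j j<k = proj₂ (proj₂ ih) i j k (s≤s⁻¹ i<j) (s≤s⁻¹ j<k)

Avoids321After⇒From : ∀ m u l → Avoids321After m u l → Avoids321From m u l
Avoids321After⇒From m u [] _ = tt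
Avoids321After⇒From m u (x ∷ l) (noneBelow , noInversion , avoids) with m ≤ᵇ x | ≤ᵇ-view m x
... | true | is≤ _ = Avoids321After⇒From x u l
      ( (λ k → noneBelow (Fin.suc k))
      , (λ j k j<k (lk<lj , lj<x) → avoids Fin.zero (Fin.suc j) (Fin.suc k) (s≤s z≤n) (s≤s j<k) (lj<x , lk<lj))
      , (λ i j k i<j j<k → avoids (Fin.suc i) (Fin.suc j) (Fin.suc k) (s≤s i<j) (s≤s j<k)))
... | false | is> x<m = ≮⇒≥ (noneBelow Fin.zero) , Avoids321After⇒From m x l
      ( (λ k lk<x → noInversion Fin.zero (Fin.suc k) (s≤s z≤n) (lk<x , x<m))
      , (λ j k j<k → noInversion (Fin.suc j) (Fin.suc k) (s≤s j<k))
      , (λ i j k i<j j<k → avoids (Fin.suc i) (Fin.suc j) (Fin.suc k) (s≤s i<j) (s≤s j<k)))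

Avoids321⇒Avoids321From : ∀ l → Avoids321 l → Avoids321From 0 0 l
Avoids321⇒Avoids321From l a = Avoids321After⇒From 0 0 l ((λ _ ()) , (λ _ _ _ (_ , lj<0) → n≮0 lj<0) , a)

Avoids321From⇒Avoids321 : ∀ l → Avoids321From 0 0 l → Avoids321 l
Avoids321From⇒Avoids321 l a = proj₂ (proj₂ (Avoids321From⇒After 0 0 l z≤n a))

StrictMonoOn : (ℕ → Set) → (ℕ → ℕ) → Set
StrictMonoOn P g = ∀ x y → P x → P y → x < y → g x < g y

module Relabel (g : ℕ → ℕ) (P : ℕ → Set) (mono : StrictMonoOn P g) where

  ≤ᵇ-preserved : ∀ x y → P x → P y → (x ≤ᵇ y) ≡ (g x ≤ᵇ g y)
  ≤ᵇ-preserved x y px py with x ≤ᵇ y | ≤ᵇ-view x y | g x ≤ᵇ g y | ≤ᵇ-view (g x) (g y)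
  ... | true  | _      | true  | _        = refl
  ... | false | _      | false | _        = refl
  ... | true  | is≤ x≤y | false | is> gy<gx with m≤n⇒m<n∨m≡n x≤y
  ...   | inj₁ x<y  = ⊥-elim (<-asym gy<gx (mono x y px py x<y))
  ...   | inj₂ refl = ⊥-elim (<-irrefl refl gy<gx)
  ≤ᵇ-preserved x y px py | false | is> y<x | true | is≤ gx≤gy = ⊥-elim (<⇒≱ (mono y x py px y<x) gx≤gy)

  ltrMask-map : ∀ m l → P m → All P l → ltrMask (g m) (map g l) ≡ ltrMask m l
  ltrMask-map m [] pm pl = refl
  ltrMask-map m (x ∷ l) pm (px ∷ pl) rewrite sym (≤ᵇ-preserved m x pm px) with m ≤ᵇ x
  ... | true  = cong (true ∷_) (ltrMask-map x l px pl)
  ... | false = cong (false ∷_) (ltrMask-map m l pm pl)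

  scanMax-map : ∀ m l → P m → All P l → scanMax (g m) (map g l) ≡ g (scanMax m l)
  scanMax-map m [] pm pl = refl
  scanMax-map m (x ∷ l) pm (px ∷ pl) rewrite sym (≤ᵇ-preserved m x pm px) with m ≤ᵇ x
  ... | true  = scanMax-map x l px pl
  ... | false = scanMax-map m l pm pl

  lastNonMax-map : ∀ m u l → P m → P u → All P l → lastNonMax (g m) (g u) (map g l) ≡ g (lastNonMax m u l)
  lastNonMax-map m u [] pm pu pl = refl
  lastNonMax-map m u (x ∷ l) pm pu (px ∷ pl) rewrite sym (≤ᵇ-preserved m x pm px) with m ≤ᵇ x
  ... | true  = lastNonMax-map x u l px pu pl
  ... | false = lastNonMax-map m x l pm px pl

  Avoids321From-map : ∀ m u l → P m → P u → All P l → Avoids321From m u l → Avoids321From (g m) (g u) (map g l)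
  Avoids321From-map m u [] pm pu pl a = tt
  Avoids321From-map m u (x ∷ l) pm pu (px ∷ pl) a rewrite sym (≤ᵇ-preserved m x pm px) with m ≤ᵇ x
  ... | true  = Avoids321From-map x u l px pu pl a
  ... | false = ≤ᵇ⇒≤ (g u) (g x) (subst T (≤ᵇ-preserved u x pu px) (≤⇒≤ᵇ (proj₁ a)))
              , Avoids321From-map m x l pm px pl (proj₂ a)

  module FromZero (P0 : P 0) (g0 : g 0 ≡ 0) {l : List ℕ} (pl : All P l) where

    ltrMask-map₀ : ltrMask 0 (map g l) ≡ ltrMask 0 l
    ltrMask-map₀ = subst (λ z → ltrMask z (map g l) ≡ ltrMask 0 l) g0 (ltrMask-map 0 l P0 pl)

    scanMax-map₀ : scanMax 0 (map g l) ≡ g (scanMax 0 l)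
    scanMax-map₀ = subst (λ z → scanMax z (map g l) ≡ g (scanMax 0 l)) g0 (scanMax-map 0 l P0 pl)

    lastNonMax-map₀ : lastNonMax 0 0 (map g l) ≡ g (lastNonMax 0 0 l)
    lastNonMax-map₀ = subst (λ z → lastNonMax z z (map g l) ≡ g (lastNonMax 0 0 l)) g0 (lastNonMax-map 0 0 l P0 P0 pl)

    Avoids321From-map₀ : Avoids321From 0 0 l → Avoids321From 0 0 (map g l)
    Avoids321From-map₀ a = subst (λ z → Avoids321From z z (map g l)) g0 (Avoids321From-map 0 0 l P0 P0 pl a)

module _ {m : ℕ} where

  ltrMask-below : ∀ Y → All (_< m) Y → ltrMask m Y ≡ replicate (length Y) false
  ltrMask-below [] _ = refl
  ltrMask-below (y ∷ Y) (y<m ∷ Y<m) = trans (ltrMask-nonMax Y y<m) (cong (false ∷_) (ltrMask-below Y Y<m))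

  ltrMask≡falses⇒below : ∀ Y k → ltrMask m Y ≡ replicate k false → All (_< m) Y
  ltrMask≡falses⇒below [] k _ = []
  ltrMask≡falses⇒below (y ∷ Y) zero eq = ⊥-elim (1+n≢0 (trans (sym (length-ltrMask m (y ∷ Y))) (cong length eq)))
  ltrMask≡falses⇒below (y ∷ Y) (suc k) eq with m ≤ᵇ y | ≤ᵇ-view m y
  ... | false | is> y<m = y<m ∷ ltrMask≡falses⇒below Y k (∷-injectiveʳ eq)
  ... | true  | _ with () ← ∷-injectiveˡ eq

Ascending : ℕ → List ℕ → Set
Ascending u [] = ⊤
Ascending u (x ∷ l) = u ≤ x × Ascending x l

lastOf : ℕ → List ℕ → ℕ
lastOf u [] = u
lastOf u (x ∷ l) = lastOf x l

module _ {m : ℕ} where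

  Avoids321From⇒Ascending : ∀ u Y → All (_< m) Y → Avoids321From m u Y → Ascending u Y
  Avoids321From⇒Ascending u [] _ _ = tt
  Avoids321From⇒Ascending u (y ∷ Y) (y<m ∷ Y<m) a rewrite Avoids321From-nonMax Y {u} y<m =
    proj₁ a , Avoids321From⇒Ascending y Y Y<m (proj₂ a)

  Ascending⇒Avoids321From : ∀ u Y → All (_< m) Y → Ascending u Y → Avoids321From m u Y
  Ascending⇒Avoids321From u [] _ _ = tt
  Ascending⇒Avoids321From u (y ∷ Y) (y<m ∷ Y<m) a rewrite Avoids321From-nonMax Y {u} y<m =
    proj₁ a , Ascending⇒Avoids321From y Y Y<m (proj₂ a)

  lastNonMax-below : ∀ u Y → All (_< m) Y → lastNonMax m u Y ≡ lastOf u Y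
  lastNonMax-below u [] _ = refl
  lastNonMax-below u (y ∷ Y) (y<m ∷ Y<m) = trans (lastNonMax-nonMax Y y<m) (lastNonMax-below y Y Y<m)

lastOf-∷ʳ : ∀ u Y x → lastOf u (Y ∷ʳ x) ≡ x
lastOf-∷ʳ u [] x = refl
lastOf-∷ʳ u (y ∷ Y) x = lastOf-∷ʳ y Y x

lastOf-initial⊎∈ : ∀ u Y → lastOf u Y ≡ u ⊎ lastOf u Y ∈ Y
lastOf-initial⊎∈ u [] = inj₁ refl
lastOf-initial⊎∈ u (y ∷ Y) with lastOf-initial⊎∈ y Y
... | inj₁ eq = inj₂ (subst (_∈ y ∷ Y) (sym eq) (here refl))
... | inj₂ ∈Y = inj₂ (there ∈Y)

Ascending-replaceLast : ∀ u Y y y′ → Ascending u (Y ∷ʳ y) → lastOf u Y ≤ y′ → Ascending u (Y ∷ʳ y′)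
Ascending-replaceLast u [] y y′ _ u≤y′ = u≤y′ , tt
Ascending-replaceLast u (x ∷ Y) y y′ (u≤x , asc) last≤y′ = u≤x , Ascending-replaceLast x Y y y′ asc last≤y′

Ascending-≤lastOf : ∀ u Z → Ascending u Z → u ≤ lastOf u Z × All (_≤ lastOf u Z) Z
Ascending-≤lastOf u [] _ = ≤-refl , []
Ascending-≤lastOf u (z ∷ Z) (u≤z , asc) with Ascending-≤lastOf z Z asc
... | z≤last , Z≤last = ≤-trans u≤z z≤last , z≤last ∷ Z≤last

Ascending-∷ʳ⁻ : ∀ u Z {y} → Ascending u (Z ∷ʳ y) → Ascending u Z
Ascending-∷ʳ⁻ u [] _ = tt
Ascending-∷ʳ⁻ u (z ∷ Z) (u≤z , asc) = u≤z , Ascending-∷ʳ⁻ z Z asc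

Ascending-max-last : ∀ u B {x} → Ascending u B → Distinct B → x ∈ B → All (_≤ x) B → ∃ λ B′ → B ≡ B′ ∷ʳ x
Ascending-max-last u (b ∷ []) asc d (here refl) _ = [] , refl
Ascending-max-last u (b ∷ b′ ∷ B) (_ , b≤b′ , _) (b∉ , _) (here refl) (_ ∷ b′≤b ∷ _) =
  ⊥-elim (b∉ (subst (_∈ b′ ∷ B) (≤-antisym b′≤b b≤b′) (here refl)))
Ascending-max-last u (b ∷ B) (_ , asc) (_ , d) (there x∈) (_ ∷ B≤x) with Ascending-max-last b B asc d x∈ B≤x
... | B′ , refl = b ∷ B′ , refl

module Run (X : List ℕ) {Z : List ℕ} (Z<max : All (_< scanMax 0 X) Z) where

  Avoids321-run⁻ : Avoids321From 0 0 (X ++ Z) → Avoids321From 0 0 X × Ascending (lastNonMax 0 0 X) Z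
  Avoids321-run⁻ a with Avoids321From-++⁻ 0 0 X Z a
  ... | aX , aZ = aX , Avoids321From⇒Ascending _ Z Z<max aZ

  Avoids321-run⁺ : Avoids321From 0 0 X → Ascending (lastNonMax 0 0 X) Z → Avoids321From 0 0 (X ++ Z)
  Avoids321-run⁺ aX asc = Avoids321From-++⁺ 0 0 X Z aX (Ascending⇒Avoids321From _ Z Z<max asc)

  lastNonMax-run : lastNonMax 0 0 (X ++ Z) ≡ lastOf (lastNonMax 0 0 X) Z
  lastNonMax-run = trans (lastNonMax-++ 0 0 X Z) (lastNonMax-below _ Z Z<max)

  ltrMask-run : ltrMask 0 (X ++ Z) ≡ ltrMask 0 X ++ replicate (length Z) false
  ltrMask-run = trans (ltrMask-++ 0 X Z) (cong (ltrMask 0 X ++_) (ltrMask-below Z Z<max))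

module NewMax (X : List ℕ) {M : ℕ} (X≤M : scanMax 0 X ≤ M) where

  scanMax-newMax : scanMax 0 (X ∷ʳ M) ≡ M
  scanMax-newMax = trans (scanMax-++ 0 X [ M ]) (scanMax-max X≤M)
    where scanMax-max : scanMax 0 X ≤ M → scanMax (scanMax 0 X) [ M ] ≡ M
          scanMax-max le with scanMax 0 X ≤ᵇ M | ≤ᵇ-view (scanMax 0 X) M
          ... | true  | _      = refl
          ... | false | is> M< = ⊥-elim (<⇒≱ M< le)

  lastNonMax-newMax : lastNonMax 0 0 (X ∷ʳ M) ≡ lastNonMax 0 0 X
  lastNonMax-newMax = trans (lastNonMax-++ 0 0 X [ M ]) (lastNonMax-max [] X≤M)

  ltrMask-newMax : ltrMask 0 (X ∷ʳ M) ≡ ltrMask 0 X ∷ʳ true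
  ltrMask-newMax = trans (ltrMask-++ 0 X [ M ]) (cong (ltrMask 0 X ++_) (ltrMask-max [] X≤M))

  Avoids321-newMax⁺ : Avoids321From 0 0 X → Avoids321From 0 0 (X ∷ʳ M)
  Avoids321-newMax⁺ aX = Avoids321From-++⁺ 0 0 X [ M ] aX (subst id (sym (Avoids321From-max [] X≤M)) tt)

  Avoids321-newMax⁻ : Avoids321From 0 0 (X ∷ʳ M) → Avoids321From 0 0 X
  Avoids321-newMax⁻ = proj₁ ∘ Avoids321From-++⁻ 0 0 X [ M ]

module MaxRun (X : List ℕ) {M : ℕ} {Z : List ℕ} (X≤M : scanMax 0 X ≤ M) (Z<M : All (_< M) Z) where

  open NewMax X X≤M
  private
    module R = Run (X ∷ʳ M) (subst (λ b → All (_< b) Z) (sym scanMax-newMax) Z<M)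
    assoc = ++-assoc X [ M ] Z

  Avoids321-maxRun⁻ : Avoids321From 0 0 (X ++ M ∷ Z) → Avoids321From 0 0 X × Ascending (lastNonMax 0 0 X) Z
  Avoids321-maxRun⁻ a with R.Avoids321-run⁻ (subst (Avoids321From 0 0) (sym assoc) a)
  ... | aXM , asc = Avoids321-newMax⁻ aXM , subst (λ u → Ascending u Z) lastNonMax-newMax asc

  Avoids321-maxRun⁺ : Avoids321From 0 0 X → Ascending (lastNonMax 0 0 X) Z → Avoids321From 0 0 (X ++ M ∷ Z)
  Avoids321-maxRun⁺ aX asc = subst (Avoids321From 0 0) assoc
    (R.Avoids321-run⁺ (Avoids321-newMax⁺ aX) (subst (λ u → Ascending u Z) (sym lastNonMax-newMax) asc))

  lastNonMax-maxRun : lastNonMax 0 0 (X ++ M ∷ Z) ≡ lastOf (lastNonMax 0 0 X) Z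
  lastNonMax-maxRun = trans (cong (lastNonMax 0 0) (sym assoc)) (trans R.lastNonMax-run (cong (λ u → lastOf u Z) lastNonMax-newMax))

  ltrMask-maxRun : ltrMask 0 (X ++ M ∷ Z) ≡ ltrMask 0 X ++ true ∷ replicate (length Z) false
  ltrMask-maxRun = trans (cong (ltrMask 0) (sym assoc)) (trans R.ltrMask-run
    (trans (cong (_++ replicate (length Z) false) ltrMask-newMax) (++-assoc (ltrMask 0 X) [ true ] _)))

module InsertMax (X : List ℕ) {M : ℕ} {Z : List ℕ} (X≤M : scanMax 0 X ≤ M) (Z<max : All (_< scanMax 0 X) Z) where

  private
    module R = Run X Z<max
    module MR = MaxRun X X≤M (All.map (λ z<max → <-≤-trans z<max X≤M) Z<max)

  Avoids321-insertMax⁻ : Avoids321From 0 0 (X ++ M ∷ Z) → Avoids321From 0 0 (X ++ Z)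
  Avoids321-insertMax⁻ a = let aX , asc = MR.Avoids321-maxRun⁻ a in R.Avoids321-run⁺ aX asc

  Avoids321-insertMax⁺ : Avoids321From 0 0 (X ++ Z) → Avoids321From 0 0 (X ++ M ∷ Z)
  Avoids321-insertMax⁺ a = let aX , asc = R.Avoids321-run⁻ a in MR.Avoids321-maxRun⁺ aX asc

ltrMask-split : ∀ σ W r → ltrMask 0 σ ≡ ltrMask 0 W ++ replicate r false →
  let X = take (length W) σ ; Z = drop (length W) σ in
  ltrMask 0 X ≡ ltrMask 0 W × All (_< scanMax 0 X) Z × length Z ≡ r
ltrMask-split σ W r eq = proj₁ halves , Z<max , |Z|≡r
  where
    X = take (length W) σ
    Z = drop (length W) σ
    |σ|≡ : length σ ≡ length W + r
    |σ|≡ = begin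
      length σ                                          ≡⟨ length-ltrMask 0 σ ⟨
      length (ltrMask 0 σ)                              ≡⟨ cong length eq ⟩
      length (ltrMask 0 W ++ replicate r false)         ≡⟨ length-++ (ltrMask 0 W) ⟩
      length (ltrMask 0 W) + length (replicate r false) ≡⟨ cong₂ _+_ (length-ltrMask 0 W) (length-replicate r) ⟩
      length W + r                                      ∎
      where open ≡-Reasoning
    |W|≤|σ| : length W ≤ length σ
    |W|≤|σ| = subst (length W ≤_) (sym |σ|≡) (m≤m+n (length W) r)
    halves : ltrMask 0 X ≡ ltrMask 0 W × ltrMask (scanMax 0 X) Z ≡ replicate r false
    halves = ++-cancel-≡length _ _ _ _
      (trans (sym (ltrMask-++ 0 X Z)) (trans (cong (ltrMask 0) (take++drop≡id (length W) σ)) eq))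
      (trans (length-ltrMask 0 X) (trans (length-take (length W) σ) (trans (m≤n⇒m⊓n≡m |W|≤|σ|) (sym (length-ltrMask 0 W)))))
    Z<max : All (_< scanMax 0 X) Z
    Z<max = ltrMask≡falses⇒below Z r (proj₂ halves)
    |Z|≡r : length Z ≡ r
    |Z|≡r = trans (sym (length-ltrMask (scanMax 0 X) Z)) (trans (cong length (proj₂ halves)) (length-replicate r))

-- Permutations of [n]

interval : ℕ → ℕ → List ℕ
interval a zero = []
interval a (suc b) = suc a ∷ interval (suc a) b

range≡interval : ∀ n → range n ≡ interval 0 n
range≡interval n = trans (map-applyUpTo id suc n) (go suc 0 n (λ _ → refl))
  where
    go : ∀ (h : ℕ → ℕ) a b → (∀ j → h j ≡ suc (a + j)) → applyUpTo h b ≡ interval a b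
    go h a zero _ = refl
    go h a (suc b) eq = cong₂ _∷_ (trans (eq 0) (cong suc (+-identityʳ a)))
      (go (h ∘ suc) (suc a) b (λ j → trans (eq (suc j)) (cong suc (+-suc a j))))

interval-++ : ∀ a b c → interval a (b + c) ≡ interval a b ++ interval (a + b) c
interval-++ a zero c = cong (λ z → interval z c) (sym (+-identityʳ a))
interval-++ a (suc b) c = cong (suc a ∷_) (trans (interval-++ (suc a) b c) (cong (λ z → interval (suc a) b ++ interval z c) (sym (+-suc a b))))

interval-∷ʳ : ∀ a b → interval a (suc b) ≡ interval a b ∷ʳ suc (a + b)
interval-∷ʳ a b = trans (cong (interval a) (+-comm 1 b)) (interval-++ a b 1)

∈-interval⁻ : ∀ a b {x} → x ∈ interval a b → a < x × x ≤ a + b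
∈-interval⁻ a (suc b) (here refl) = ≤-refl , ≤-trans (m≤m+n (suc a) b) (≤-reflexive (sym (+-suc a b)))
∈-interval⁻ a (suc b) {x} (there x∈) with ∈-interval⁻ (suc a) b x∈
... | a+1<x , x≤ = <-trans (n<1+n a) a+1<x , subst (x ≤_) (sym (+-suc a b)) x≤

∈-interval⁺ : ∀ a b {x} → a < x → x ≤ a + b → x ∈ interval a b
∈-interval⁺ a zero {x} a<x x≤a+0 = ⊥-elim (<⇒≱ a<x (subst (x ≤_) (+-identityʳ a) x≤a+0))
∈-interval⁺ a (suc b) {x} a<x x≤ with x ≟ suc a
... | yes refl = here refl
... | no x≢   = there (∈-interval⁺ (suc a) b (≤∧≢⇒< a<x (x≢ ∘ sym)) (subst (x ≤_) (+-suc a b) x≤))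

length-interval : ∀ a b → length (interval a b) ≡ b
length-interval a zero = refl
length-interval a (suc b) = cong suc (length-interval (suc a) b)

Distinct-interval : ∀ a b → Distinct (interval a b)
Distinct-interval a zero = tt
Distinct-interval a (suc b) = (λ a+1∈ → <-irrefl refl (proj₁ (∈-interval⁻ (suc a) b a+1∈))) , Distinct-interval (suc a) b

Perm : ℕ → List ℕ → Set
Perm n π = π ↭ interval 0 n

IsPerm⇒Perm : ∀ {n π} → IsPerm n π → Perm n π
IsPerm⇒Perm {n} = subst (_ ↭_) (range≡interval n)

Perm⇒IsPerm : ∀ {n π} → Perm n π → IsPerm n π
Perm⇒IsPerm {n} = subst (_ ↭_) (sym (range≡interval n))

module _ {n : ℕ} {π : List ℕ} (p : Perm n π) where

  Perm-∈⇒bounds : ∀ {x} → x ∈ π → 1 ≤ x × x ≤ n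
  Perm-∈⇒bounds x∈ = ∈-interval⁻ 0 n (∈-resp-↭ p x∈)

  Perm-∈⇒≤ : ∀ {x} → x ∈ π → x ≤ n
  Perm-∈⇒≤ = proj₂ ∘ Perm-∈⇒bounds

  Perm-∋ : ∀ {x} → 1 ≤ x → x ≤ n → x ∈ π
  Perm-∋ 1≤x x≤n = ∈-resp-↭ (↭-sym p) (∈-interval⁺ 0 n 1≤x x≤n)

  Perm-∋max : n ≢ 0 → n ∈ π
  Perm-∋max n≢0 = Perm-∋ (n≢0⇒n>0 n≢0) ≤-refl

  Perm⇒Distinct : Distinct π
  Perm⇒Distinct = Distinct-resp-↭ (↭-sym p) (Distinct-interval 0 n)

  Perm⇒length : length π ≡ n
  Perm⇒length = trans (↭-length p) (length-interval 0 n)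

  Perm⇒All≤ : All (_≤ n) π
  Perm⇒All≤ = All.tabulate Perm-∈⇒≤

  Perm-≢max⇒< : ∀ {x} → x ∈ π → x ≢ n → x < n
  Perm-≢max⇒< x∈ x≢n = ≤∧≢⇒< (Perm-∈⇒≤ x∈) x≢n

interval-suc↭ : ∀ n → interval 0 (suc n) ↭ suc n ∷ interval 0 n
interval-suc↭ n = subst (_↭ suc n ∷ interval 0 n) (sym (interval-∷ʳ 0 n))
  (↭-trans (shift (suc n) (interval 0 n) []) (prep (suc n) (↭-reflexive (++-identityʳ (interval 0 n)))))

module _ {n : ℕ} (A B : List ℕ) where

  Perm-insert⁺ : Perm n (A ++ B) → Perm (suc n) (A ++ suc n ∷ B)
  Perm-insert⁺ p = ↭-trans (shift (suc n) A B) (↭-trans (prep (suc n) p) (↭-sym (interval-suc↭ n)))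

  Perm-insert⁻ : Perm (suc n) (A ++ suc n ∷ B) → Perm n (A ++ B)
  Perm-insert⁻ p = drop-∷ (↭-trans (↭-sym (shift (suc n) A B)) (↭-trans p (interval-suc↭ n)))

module _ {n : ℕ} (σ : List ℕ) where

  Perm-∷ʳ⁺ : Perm n σ → Perm (suc n) (σ ∷ʳ suc n)
  Perm-∷ʳ⁺ p = Perm-insert⁺ σ [] (subst (Perm n) (sym (++-identityʳ σ)) p)

  Perm-∷ʳ⁻ : Perm (suc n) (σ ∷ʳ suc n) → Perm n σ
  Perm-∷ʳ⁻ p = subst (Perm n) (++-identityʳ σ) (Perm-insert⁻ σ [] p)

Perm-map : ∀ {n π} (g : ℕ → ℕ) → map g (interval 0 n) ↭ interval 0 n → Perm n π → Perm n (map g π)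
Perm-map g g-perm p = ↭-trans (map⁺ g p) g-perm

Perm-zero : ∀ {π} → Perm 0 π → π ≡ []
Perm-zero {[]} _ = refl
Perm-zero {_ ∷ _} p with Perm⇒length p
... | ()

Perm-one : ∀ {π} → Perm 1 π → π ≡ [ 1 ]
Perm-one {π} p with ∷ʳ-view π (Perm⇒length p)
... | [] , x , refl with Perm-∈⇒bounds p (here refl)
...   | s≤s z≤n , s≤s z≤n = refl
Perm-one {π} p | y ∷ I , x , refl with trans (sym (Perm⇒length p)) (length-∷ʳ (y ∷ I) x)
... | ()

scanMax-Perm : ∀ {n l} → Perm n l → n ≢ 0 → scanMax 0 l ≡ n
scanMax-Perm p n≢0 = ≤-antisym (scanMax-lub 0 _ z≤n (Perm⇒All≤ p)) (∈⇒≤scanMax 0 _ (Perm-∋max p n≢0))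

lastNonMax-Perm : ∀ {N l} → Perm (suc N) l → lastNonMax 0 0 l ≤ N
lastNonMax-Perm {N} {l} p with lastNonMax-initial⊎∈ 0 0 l
... | inj₁ eq           = subst (_≤ N) (sym eq) z≤n
... | inj₂ (_ , c<max) = s≤s⁻¹ (subst (lastNonMax 0 0 l <_) (scanMax-Perm p (λ ())) c<max)

pos-++ : ∀ v A B → v ∉ A → pos v (A ++ B) ≡ length A + pos v B
pos-++ v [] B _ = refl
pos-++ v (x ∷ A) B h with x ≡ᵇ v | ≡ᵇ-reflects-≡ x v
... | true | ofʸ refl = ⊥-elim (h (here refl))
... | false | _ = cong suc (pos-++ v A B (h ∘ there))

pos-head : ∀ v B → pos v (v ∷ B) ≡ 0
pos-head v B with v ≡ᵇ v | ≡ᵇ-reflects-≡ v v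
... | true | _ = refl
... | false | ofⁿ ne = ⊥-elim (ne refl)

pos-∷-≢ : ∀ v x l → x ≢ v → pos v (x ∷ l) ≡ suc (pos v l)
pos-∷-≢ v x l x≢v with x ≡ᵇ v | ≡ᵇ-reflects-≡ x v
... | true  | ofʸ x≡v = ⊥-elim (x≢v x≡v)
... | false | _       = refl

pos-insert : ∀ v A B → v ∉ A → pos v (A ++ v ∷ B) ≡ length A
pos-insert v A B h = trans (pos-++ v A (v ∷ B) h) (trans (cong (length A +_) (pos-head v B)) (+-identityʳ _))

pos-∈-< : ∀ v A B → v ∈ A → pos v (A ++ B) < length A
pos-∈-< v (x ∷ A) B i with x ≡ᵇ v | ≡ᵇ-reflects-≡ x v
... | true | _ = s≤s z≤n
... | false | ofⁿ ne with i
...   | here e = ⊥-elim (ne (sym e))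
...   | there j = s≤s (pos-∈-< v A B j)

remove-∉ : ∀ v l → v ∉ l → remove v l ≡ l
remove-∉ v [] _ = refl
remove-∉ v (x ∷ l) h with x ≡ᵇ v | ≡ᵇ-reflects-≡ x v
... | true | ofʸ refl = ⊥-elim (h (here refl))
... | false | _ = cong (x ∷_) (remove-∉ v l (h ∘ there))

remove-insert : ∀ v A B → v ∉ A → v ∉ B → remove v (A ++ v ∷ B) ≡ A ++ B
remove-insert v [] B _ hB with v ≡ᵇ v | ≡ᵇ-reflects-≡ v v
... | true | _ = remove-∉ v B hB
... | false | ofⁿ ne = ⊥-elim (ne refl)
remove-insert v (x ∷ A) B hA hB with x ≡ᵇ v | ≡ᵇ-reflects-≡ x v
... | true | ofʸ refl = ⊥-elim (hA (here refl))
... | false | _ = cong (x ∷_) (remove-insert v A B (hA ∘ there) hB)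

transpVal-a : ∀ a b → transpVal a b a ≡ b
transpVal-a a b with a ≡ᵇ a | ≡ᵇ-reflects-≡ a a
... | true | _ = refl
... | false | ofⁿ ne = ⊥-elim (ne refl)

transpVal-b : ∀ a b → b ≢ a → transpVal a b b ≡ a
transpVal-b a b ne with b ≡ᵇ a | ≡ᵇ-reflects-≡ b a
... | true | ofʸ e = ⊥-elim (ne e)
... | false | _ with b ≡ᵇ b | ≡ᵇ-reflects-≡ b b
...   | true | _ = refl
...   | false | ofⁿ ne' = ⊥-elim (ne' refl)

transpVal-other : ∀ a b x → x ≢ a → x ≢ b → transpVal a b x ≡ x
transpVal-other a b x na nb with x ≡ᵇ a | ≡ᵇ-reflects-≡ x a
... | true | ofʸ e = ⊥-elim (na e)
... | false | _ with x ≡ᵇ b | ≡ᵇ-reflects-≡ x b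
...   | true | ofʸ e = ⊥-elim (nb e)
...   | false | _ = refl

transpVal-involutive : ∀ a b x → transpVal a b (transpVal a b x) ≡ x
transpVal-involutive a b x with x ≟ a | x ≟ b
... | yes refl | _ with b ≟ x
...   | yes refl = trans (cong (transpVal x x) (transpVal-a x x)) (transpVal-a x x)
...   | no ne = trans (cong (transpVal x b) (transpVal-a x b)) (transpVal-b x b ne)
transpVal-involutive a b x | no na | yes refl = trans (cong (transpVal a x) (transpVal-b a x na)) (transpVal-a a x)
transpVal-involutive a b x | no na | no nb = trans (cong (transpVal a b) (transpVal-other a b x na nb)) (transpVal-other a b x na nb)

cycVal-inside : ∀ a b x → a ≤ x → x < b → cycVal a b x ≡ suc x
cycVal-inside a b x ax xb with a ≤ᵇ x | ≤ᵇ-view a x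
... | false | is> xa = ⊥-elim (<⇒≱ xa ax)
... | true | _ with x <ᵇ b | <ᵇ-reflects-< x b
...   | true | _ = refl
...   | false | ofⁿ nxb = ⊥-elim (nxb xb)

cycVal-end : ∀ a b → a ≤ b → cycVal a b b ≡ a
cycVal-end a b ab with a ≤ᵇ b
... | true with b <ᵇ b | <ᵇ-reflects-< b b
...   | true | ofʸ bb = ⊥-elim (<-irrefl refl bb)
...   | false | _ with b ≡ᵇ b | ≡ᵇ-reflects-≡ b b
...     | true | _ = refl
...     | false | ofⁿ ne = ⊥-elim (ne refl)
cycVal-end a b ab | false with b ≡ᵇ b | ≡ᵇ-reflects-≡ b b
...     | true | _ = refl
...     | false | ofⁿ ne = ⊥-elim (ne refl)

cycVal-below : ∀ a b x → a ≤ b → x < a → cycVal a b x ≡ x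
cycVal-below a b x ab xa with a ≤ᵇ x | ≤ᵇ-view a x
... | true | is≤ ax = ⊥-elim (<⇒≱ xa ax)
... | false | _ with x ≡ᵇ b | ≡ᵇ-reflects-≡ x b
...   | true | ofʸ refl = ⊥-elim (<⇒≱ xa ab)
...   | false | _ = refl

cycVal-above : ∀ a b x → b < x → cycVal a b x ≡ x
cycVal-above a b x bx with a ≤ᵇ x
... | true with x <ᵇ b | <ᵇ-reflects-< x b
...   | true | ofʸ xb = ⊥-elim (<-asym xb bx)
...   | false | _ with x ≡ᵇ b | ≡ᵇ-reflects-≡ x b
...     | true | ofʸ refl = ⊥-elim (<-irrefl refl bx)
...     | false | _ = refl
cycVal-above a b x bx | false with x ≡ᵇ b | ≡ᵇ-reflects-≡ x b
...     | true | ofʸ refl = ⊥-elim (<-irrefl refl bx)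
...     | false | _ = refl

-- The inverse of cycVal a b, for a ≤ b.
cycInvVal : ℕ → ℕ → ℕ → ℕ
cycInvVal a b x = if x ≡ᵇ a then b else (if (a <ᵇ x) ∧ (x ≤ᵇ b) then x ∸ 1 else x)

cycInvVal-start : ∀ a b → cycInvVal a b a ≡ b
cycInvVal-start a b with a ≡ᵇ a | ≡ᵇ-reflects-≡ a a
... | true | _ = refl
... | false | ofⁿ ne = ⊥-elim (ne refl)

cycInvVal-inside : ∀ a b x → a < x → x ≤ b → cycInvVal a b x ≡ x ∸ 1
cycInvVal-inside a b x ax xb with x ≡ᵇ a | ≡ᵇ-reflects-≡ x a
... | true | ofʸ refl = ⊥-elim (<-irrefl refl ax)
... | false | _ with a <ᵇ x | <ᵇ-reflects-< a x
...   | false | ofⁿ n = ⊥-elim (n ax)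
...   | true | _ with x ≤ᵇ b | ≤ᵇ-view x b
...     | true | _ = refl
...     | false | is> bx = ⊥-elim (<⇒≱ bx xb)

cycInvVal-below : ∀ a b x → x < a → cycInvVal a b x ≡ x
cycInvVal-below a b x xa with x ≡ᵇ a | ≡ᵇ-reflects-≡ x a
... | true | ofʸ refl = ⊥-elim (<-irrefl refl xa)
... | false | _ with a <ᵇ x | <ᵇ-reflects-< a x
...   | true | ofʸ ax = ⊥-elim (<-asym ax xa)
...   | false | _ = refl

cycInvVal-above : ∀ a b x → a ≤ b → b < x → cycInvVal a b x ≡ x
cycInvVal-above a b x ab bx with x ≡ᵇ a | ≡ᵇ-reflects-≡ x a
... | true | ofʸ refl = ⊥-elim (<⇒≱ bx ab)
... | false | _ with a <ᵇ x
...   | false = refl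
...   | true with x ≤ᵇ b | ≤ᵇ-view x b
...     | true | is≤ xb = ⊥-elim (<⇒≱ bx xb)
...     | false | _ = refl

cycInvVal-cycVal : ∀ a b x → a ≤ b → cycInvVal a b (cycVal a b x) ≡ x
cycInvVal-cycVal a b x ab with <-cmp x a
... | tri< xa _ _ = trans (cong (cycInvVal a b) (cycVal-below a b x ab xa)) (cycInvVal-below a b x xa)
... | tri≈ _ refl _ with <-cmp x b
...   | tri< xb _ _ = trans (cong (cycInvVal x b) (cycVal-inside x b x ≤-refl xb)) (cycInvVal-inside x b (suc x) ≤-refl xb)
...   | tri≈ _ refl _ = trans (cong (cycInvVal x x) (cycVal-end x x ≤-refl)) (cycInvVal-start x x)
...   | tri> _ _ bx = ⊥-elim (<⇒≱ bx ab)
cycInvVal-cycVal a b x ab | tri> _ _ ax with <-cmp x b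
...   | tri< xb _ _ = trans (cong (cycInvVal a b) (cycVal-inside a b x (<⇒≤ ax) xb)) (cycInvVal-inside a b (suc x) (<-trans ax (n<1+n x)) xb)
...   | tri≈ _ refl _ = trans (cong (cycInvVal a x) (cycVal-end a x ab)) (cycInvVal-start a x)
...   | tri> _ _ bx = trans (cong (cycInvVal a b) (cycVal-above a b x bx)) (cycInvVal-above a b x ab bx)

cycVal-cycInvVal : ∀ a b x → a ≤ b → cycVal a b (cycInvVal a b x) ≡ x
cycVal-cycInvVal a b x ab with <-cmp x a
... | tri< xa _ _ = trans (cong (cycVal a b) (cycInvVal-below a b x xa)) (cycVal-below a b x ab xa)
... | tri≈ _ refl _ = trans (cong (cycVal x b) (cycInvVal-start x b)) (cycVal-end x b ab)
... | tri> _ _ ax = cv-ci' a b x ab ax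
  where
    cv-ci' : ∀ a b x → a ≤ b → a < x → cycVal a b (cycInvVal a b x) ≡ x
    cv-ci' a b (suc x') ab ax with <-cmp (suc x') b
    ... | tri> _ _ bx = trans (cong (cycVal a b) (cycInvVal-above a b (suc x') ab bx)) (cycVal-above a b (suc x') bx)
    ... | tri< xb _ _ = trans (cong (cycVal a b) (cycInvVal-inside a b (suc x') ax (<⇒≤ xb))) (cycVal-inside a b x' (s≤s⁻¹ ax) (<-trans (n<1+n x') xb))
    ... | tri≈ _ refl _ = trans (cong (cycVal a (suc x')) (cycInvVal-inside a (suc x') (suc x') ax ≤-refl)) (cycVal-inside a (suc x') x' (s≤s⁻¹ ax) (n<1+n x'))

transpVal-strictMono-≢a : ∀ c → StrictMonoOn (λ x → x ≢ c) (transpVal c (suc c))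
transpVal-strictMono-≢a c x y px py xy with x ≟ suc c | y ≟ suc c
... | yes refl | yes refl = ⊥-elim (<-irrefl refl xy)
... | yes refl | no ny = subst (_< transpVal c (suc c) y) (sym (transpVal-b c (suc c) (1+n≢n))) (subst (c <_) (sym (transpVal-other c (suc c) y py ny)) (<-trans (n<1+n c) xy))
... | no nx | yes refl = subst (transpVal c (suc c) x <_) (sym (transpVal-b c (suc c) 1+n≢n)) (subst (_< c) (sym (transpVal-other c (suc c) x px nx)) (≤∧≢⇒< (s≤s⁻¹ xy) px))
... | no nx | no ny = subst₂ _<_ (sym (transpVal-other c (suc c) x px nx)) (sym (transpVal-other c (suc c) y py ny)) xy

transpVal-strictMono-≢b : ∀ c → StrictMonoOn (λ x → x ≢ suc c) (transpVal c (suc c))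
transpVal-strictMono-≢b c x y px py xy with x ≟ c | y ≟ c
... | yes refl | yes refl = ⊥-elim (<-irrefl refl xy)
... | yes refl | no ny = subst (_< transpVal x (suc x) y) (sym (transpVal-a x (suc x))) (subst (suc x <_) (sym (transpVal-other x (suc x) y ny py)) (≤∧≢⇒< xy (py ∘ sym)))
... | no nx | yes refl = subst (transpVal y (suc y) x <_) (sym (transpVal-a y (suc y))) (subst (_< suc y) (sym (transpVal-other y (suc y) x nx px)) (<-trans xy (n<1+n y)))
... | no nx | no ny = subst₂ _<_ (sym (transpVal-other c (suc c) x nx px)) (sym (transpVal-other c (suc c) y ny py)) xy

cycVal-strictMono : ∀ a b → a ≤ b → StrictMonoOn (λ x → x < b) (cycVal a b)
cycVal-strictMono a b ab x y xb yb xy with <-cmp y a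
... | tri< ya _ _ = subst₂ _<_ (sym (cycVal-below a b x ab (<-trans xy ya))) (sym (cycVal-below a b y ab ya)) xy
... | tri≈ _ refl _ = subst₂ _<_ (sym (cycVal-below y b x ab xy)) (sym (cycVal-inside y b y ≤-refl yb)) (<-trans xy (n<1+n y))
... | tri> _ _ ay with <-cmp x a
...   | tri< xa _ _ = subst₂ _<_ (sym (cycVal-below a b x ab xa)) (sym (cycVal-inside a b y (<⇒≤ ay) yb)) (<-trans xy (n<1+n y))
...   | tri≈ _ refl _ = subst₂ _<_ (sym (cycVal-inside x b x ≤-refl xb)) (sym (cycVal-inside x b y (<⇒≤ ay) yb)) (s≤s xy)
...   | tri> _ _ ax = subst₂ _<_ (sym (cycVal-inside a b x (<⇒≤ ax) xb)) (sym (cycVal-inside a b y (<⇒≤ ay) yb)) (s≤s xy)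

cycInvVal-cases : ∀ a b x → a ≤ b → x ≢ a → (x < a × cycInvVal a b x ≡ x) ⊎ (a < x × x ≤ b × cycInvVal a b x ≡ x ∸ 1) ⊎ (b < x × cycInvVal a b x ≡ x)
cycInvVal-cases a b x ab nx with <-cmp x a
... | tri< xa _ _ = inj₁ (xa , cycInvVal-below a b x xa)
... | tri≈ _ e _ = ⊥-elim (nx e)
... | tri> _ _ ax with x ≤? b
...   | yes xb = inj₂ (inj₁ (ax , xb , cycInvVal-inside a b x ax xb))
...   | no nxb = inj₂ (inj₂ (≰⇒> nxb , cycInvVal-above a b x ab (≰⇒> nxb)))

cycInvVal-strictMono : ∀ a b → a ≤ b → StrictMonoOn (λ x → x ≢ a) (cycInvVal a b)
cycInvVal-strictMono a b ab x y px py xy with cycInvVal-cases a b x ab px | cycInvVal-cases a b y ab py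
... | inj₁ (xa , ex) | inj₁ (ya , ey) = subst₂ _<_ (sym ex) (sym ey) xy
... | inj₁ (xa , ex) | inj₂ (inj₁ (ay , yb , ey)) = subst₂ _<_ (sym ex) (sym ey) (<-≤-trans xa (predMono ay))
  where predMono : ∀ {a y} → a < y → a ≤ y ∸ 1
        predMono (s≤s h) = h
... | inj₁ (xa , ex) | inj₂ (inj₂ (by , ey)) = subst₂ _<_ (sym ex) (sym ey) xy
... | inj₂ (inj₁ (ax , xb , ex)) | inj₁ (ya , ey) = ⊥-elim (<-asym (<-trans ax xy) ya)
... | inj₂ (inj₁ (ax , xb , ex)) | inj₂ (inj₁ (ay , yb , ey)) = subst₂ _<_ (sym ex) (sym ey) (subMono xy (≤-<-trans z≤n ax))
  where subMono : ∀ {x y} → x < y → 1 ≤ x → x ∸ 1 < y ∸ 1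
        subMono {suc x} {suc y} (s≤s h) _ = h
... | inj₂ (inj₁ (ax , xb , ex)) | inj₂ (inj₂ (by , ey)) = subst₂ _<_ (sym ex) (sym ey) (≤-<-trans (m∸n≤m x 1) (<-≤-trans xy ≤-refl))
... | inj₂ (inj₂ (bx , ex)) | inj₁ (ya , ey) = ⊥-elim (<-asym (<-trans (≤-<-trans ab bx) xy) ya)
... | inj₂ (inj₂ (bx , ex)) | inj₂ (inj₁ (ay , yb , ey)) = ⊥-elim (<⇒≱ (<-trans bx xy) yb)
... | inj₂ (inj₂ (bx , ex)) | inj₂ (inj₂ (by , ey)) = subst₂ _<_ (sym ex) (sym ey) xy

map-interval-fixed : ∀ (g : ℕ → ℕ) a b → (∀ x → a < x → x ≤ a + b → g x ≡ x) → map g (interval a b) ≡ interval a b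
map-interval-fixed g a zero fix = refl
map-interval-fixed g a (suc b) fix = cong₂ _∷_ (fix (suc a) ≤-refl (≤-trans (m≤m+n (suc a) b) (≤-reflexive (sym (+-suc a b)))))
  (map-interval-fixed g (suc a) b (λ x a+1<x x≤ → fix x (<-trans (n<1+n a) a+1<x) (subst (x ≤_) (sym (+-suc a b)) x≤)))

map-interval-shift : ∀ (g : ℕ → ℕ) a b → (∀ x → a < x → x ≤ a + b → g x ≡ suc x) → map g (interval a b) ≡ interval (suc a) b
map-interval-shift g a zero shift = refl
map-interval-shift g a (suc b) shift = cong₂ _∷_ (shift (suc a) ≤-refl (≤-trans (m≤m+n (suc a) b) (≤-reflexive (sym (+-suc a b)))))
  (map-interval-shift g (suc a) b (λ x a+1<x x≤ → shift x (<-trans (n<1+n a) a+1<x) (subst (x ≤_) (sym (+-suc a b)) x≤)))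

map-interval-unshift : ∀ (g : ℕ → ℕ) a b → (∀ x → suc a < x → x ≤ suc a + b → g x ≡ x ∸ 1) → map g (interval (suc a) b) ≡ interval a b
map-interval-unshift g a zero unshift = refl
map-interval-unshift g a (suc b) unshift = cong₂ _∷_ (unshift (suc (suc a)) ≤-refl (s≤s (≤-trans (m≤m+n (suc a) b) (≤-reflexive (sym (+-suc a b))))))
  (map-interval-unshift g (suc a) b (λ x a+2<x x≤ → unshift x (<-trans (n<1+n (suc a)) a+2<x) (subst (x ≤_) (cong suc (sym (+-suc a b))) x≤)))

map-interval-split : ∀ (g : ℕ → ℕ) a r → (∀ x → x ≤ a → g x ≡ x) →
  map g (interval a r) ↭ interval a r → map g (interval 0 (a + r)) ↭ interval 0 (a + r)
map-interval-split g a r fix perm rewrite interval-++ 0 a r | map-++ g (interval 0 a) (interval a r) =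
  ++⁺ (↭-reflexive (map-interval-fixed g 0 a (λ x _ x≤a → fix x x≤a))) perm

transp-permutes-interval : ∀ c n → 1 ≤ c → c < n → map (transpVal c (suc c)) (interval 0 n) ↭ interval 0 n
transp-permutes-interval (suc c) n _ c<n with m≤n⇒∃[o]m+o≡n c<n
... | r , refl = subst (λ z → map t (interval 0 z) ↭ interval 0 z) (trans (+-suc c (suc r)) (cong suc (+-suc c r)))
      (map-interval-split t c (2 + r) (λ x x≤c → transpVal-other _ _ x (λ { refl → 1+n≰n x≤c }) (λ { refl → 1+n≰n (≤-trans (n≤1+n _) x≤c) }))
        (subst (_↭ interval c (2 + r)) (sym swapped) (swap (suc (suc c)) (suc c) ↭-refl)))
  where
    t = transpVal (suc c) (suc (suc c))
    swapped : map t (interval c (2 + r)) ≡ suc (suc c) ∷ suc c ∷ interval (suc (suc c)) r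
    swapped = cong₂ _∷_ (transpVal-a (suc c) (suc (suc c))) (cong₂ _∷_ (transpVal-b (suc c) (suc (suc c)) 1+n≢n)
      (map-interval-fixed t (suc (suc c)) r (λ x c+2<x _ → transpVal-other _ _ x (λ { refl → <-asym c+2<x (n<1+n _) }) (λ { refl → <-irrefl refl c+2<x }))))

cyc-permutes-interval : ∀ a n → 1 ≤ a → a ≤ n → map (cycVal a n) (interval 0 n) ↭ interval 0 n
cyc-permutes-interval (suc a) n _ a<n with m≤n⇒∃[o]m+o≡n a<n
... | r , refl = subst (λ z → map (cycVal (suc a) z) (interval 0 z) ↭ interval 0 z) (+-suc a r)
      (map-interval-split g a (suc r) (λ x x≤a → cycVal-below _ _ x a+1≤n (s≤s x≤a))
        (subst (_↭ interval a (suc r)) (sym rotated) (↭-trans (shift (suc a) (interval (suc a) r) []) (prep (suc a) (↭-reflexive (++-identityʳ _))))))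
  where
    g = cycVal (suc a) (a + suc r)
    a+1≤n : suc a ≤ a + suc r
    a+1≤n = subst (suc a ≤_) (sym (+-suc a r)) (s≤s (m≤m+n a r))
    rotated : map g (interval a (suc r)) ≡ interval (suc a) r ∷ʳ suc a
    rotated = trans (cong (map g) (interval-∷ʳ a r)) (trans (map-++ g (interval a r) [ suc (a + r) ])
      (cong₂ _++_ (map-interval-shift g a r (λ x a<x x≤ → cycVal-inside _ _ x a<x (subst (x <_) (sym (+-suc a r)) (s≤s x≤))))
                  (cong [_] (trans (cong g (sym (+-suc a r))) (cycVal-end _ _ a+1≤n)))))

cycInv-permutes-interval : ∀ a n → 1 ≤ a → a ≤ n → map (cycInvVal a n) (interval 0 n) ↭ interval 0 n
cycInv-permutes-interval (suc a) n _ a<n with m≤n⇒∃[o]m+o≡n a<n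
... | r , refl = subst (λ z → map (cycInvVal (suc a) z) (interval 0 z) ↭ interval 0 z) (+-suc a r)
      (map-interval-split h a (suc r) (λ x x≤a → cycInvVal-below _ _ x (s≤s x≤a))
        (subst (_↭ interval a (suc r)) (sym rotated) (↭-sym (↭-trans (↭-reflexive last) (↭-trans (shift b (interval a r) []) (prep b (↭-reflexive (++-identityʳ _))))))))
  where
    b = a + suc r
    h = cycInvVal (suc a) b
    last : interval a (suc r) ≡ interval a r ∷ʳ b
    last = trans (interval-∷ʳ a r) (cong (interval a r ∷ʳ_) (sym (+-suc a r)))
    rotated : map h (interval a (suc r)) ≡ b ∷ interval a r
    rotated = cong₂ _∷_ (cycInvVal-start (suc a) b) (map-interval-unshift h a r (λ x a+1<x x≤ → cycInvVal-inside _ _ x a+1<x (subst (x ≤_) (sym (+-suc a r)) x≤)))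

-- The descents of the inverse

pos-∷-< : ∀ {x l y z} → x ∉ l → y ∈ l → z ∈ l → pos y l < pos z l → pos y (x ∷ l) < pos z (x ∷ l)
pos-∷-< {x} {l} x∉ y∈l z∈l lt = subst₂ _<_ (sym (pos-∷-≢ _ x l λ { refl → x∉ y∈l })) (sym (pos-∷-≢ _ x l λ { refl → x∉ z∈l })) (s≤s lt)

pos-head-< : ∀ {x c} l → x ≡ suc c → pos (suc c) (x ∷ l) < pos c (x ∷ l)
pos-head-< {x} {c} l refl = subst₂ _<_ (sym (pos-head x l)) (sym (pos-∷-≢ c x l 1+n≢n)) (s≤s z≤n)

-- Every letter above the last non-maximum is a left-to-right maximum, so these letters increase.
pos-increasing-above-lastNonMax : ∀ m u l {y z} → Avoids321From m u l → Distinct l → y ∈ l → z ∈ l →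
  lastNonMax m u l < y → y < z → pos y l < pos z l
pos-increasing-above-lastNonMax m u (x ∷ l) a d y∈ z∈ c<y y<z with m ≤ᵇ x | ≤ᵇ-view m x | y∈ | z∈
... | _     | _       | here refl  | _          = subst (pos x (x ∷ l) <_) (sym (pos-∷-≢ _ x l (<⇒≢ y<z))) (subst (_< suc (pos _ l)) (sym (pos-head x l)) (s≤s z≤n))
... | true  | _       | there y∈l  | here refl  = ⊥-elim (<⇒≱ c<y (<max⇒≤lastNonMax x u l a y∈l y<z))
... | false | is> x<m | there y∈l  | here refl  = ⊥-elim (<⇒≱ c<y (<max⇒≤lastNonMax m x l (proj₂ a) y∈l (<-trans y<z x<m)))
... | true  | _       | there y∈l  | there z∈l  = pos-∷-< (proj₁ d) y∈l z∈l (pos-increasing-above-lastNonMax x u l a (proj₂ d) y∈l z∈l c<y y<z)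
... | false | _       | there y∈l  | there z∈l  = pos-∷-< (proj₁ d) y∈l z∈l (pos-increasing-above-lastNonMax m x l (proj₂ a) (proj₂ d) y∈l z∈l c<y y<z)

-- The last non-maximum c has a larger letter before it; c + 1 is a maximum, so it comes before c as well.
pos-suc-lastNonMax-< : ∀ m u l → Avoids321From m u l → Distinct l → m ∉ l → lastNonMax m u l ≢ u →
  suc (lastNonMax m u l) ∈ l → pos (suc (lastNonMax m u l)) l < pos (lastNonMax m u l) l
pos-suc-lastNonMax-< m u (x ∷ l) a (x∉ , d) m∉ c≢u c+1∈ with m ≤ᵇ x | ≤ᵇ-view m x
... | true | is≤ _ with x ≟ suc (lastNonMax x u l) | x ≟ lastNonMax x u l
...   | yes x≡c+1 | _ = pos-head-< l x≡c+1
...   | no _ | yes x≡c with lastNonMax-initial⊎∈ x u l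
...     | inj₁ c≡u      = ⊥-elim (c≢u c≡u)
...     | inj₂ (c∈l , _) = ⊥-elim (x∉ (subst (_∈ l) (sym x≡c) c∈l))
pos-suc-lastNonMax-< m u (x ∷ l) a (x∉ , d) m∉ c≢u (here x≡) | true | is≤ _ | no x≢c+1 | no _ = ⊥-elim (x≢c+1 (sym x≡))
pos-suc-lastNonMax-< m u (x ∷ l) a (x∉ , d) m∉ c≢u (there c+1∈) | true | is≤ _ | no x≢c+1 | no x≢c =
  subst₂ _<_ (sym (pos-∷-≢ _ x l x≢c+1)) (sym (pos-∷-≢ _ x l x≢c)) (s≤s (pos-suc-lastNonMax-< x u l a d x∉ c≢u c+1∈))
pos-suc-lastNonMax-< m u (x ∷ l) a (x∉ , d) m∉ c≢u c+1∈ | false | is> x<m with x ≟ suc (lastNonMax m x l) | x ≟ lastNonMax m x l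
...   | yes x≡c+1 | _ = pos-head-< l x≡c+1
...   | no x≢c+1 | yes x≡c with c+1∈
...     | here x≡      = ⊥-elim (x≢c+1 (sym x≡))
...     | there c+1∈l = ⊥-elim (1+n≰n (<max⇒≤lastNonMax m x l (proj₂ a) c+1∈l c+1<m))
  where
    c+1<m : suc (lastNonMax m x l) < m
    c+1<m = ≤∧≢⇒< (subst (λ z → suc z ≤ m) x≡c x<m) (λ c+1≡m → m∉ (there (subst (_∈ l) c+1≡m c+1∈l)))
pos-suc-lastNonMax-< m u (x ∷ l) a (x∉ , d) m∉ c≢u (here x≡) | false | is> _ | no x≢c+1 | no _ = ⊥-elim (x≢c+1 (sym x≡))
pos-suc-lastNonMax-< m u (x ∷ l) a (x∉ , d) m∉ c≢u (there c+1∈) | false | is> _ | no x≢c+1 | no x≢c =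
  subst₂ _<_ (sym (pos-∷-≢ _ x l x≢c+1)) (sym (pos-∷-≢ _ x l x≢c))
    (s≤s (pos-suc-lastNonMax-< m x l (proj₂ a) d (m∉ ∘ there) (x≢c ∘ sym) c+1∈))

-- Descent positions of map h [a+1 .. a+b], numbered from a + 1.
∈-descAux-interval⁻ : ∀ (h : ℕ → ℕ) a b {x} → x ∈ descAux (suc a) (map h (interval a b)) →
  a < x × suc x ≤ a + b × h (suc x) < h x
∈-descAux-interval⁻ h a zero ()
∈-descAux-interval⁻ h a (suc zero) ()
∈-descAux-interval⁻ h a (suc (suc b)) {x} x∈ = cases (∈-descAux-interval⁻ h (suc a) (suc b)) _ (<ᵇ-reflects-< (h (suc (suc a))) (h (suc a))) x∈
  where
    widen : ∀ {x} → suc a < x × suc x ≤ suc a + suc b × h (suc x) < h x → a < x × suc x ≤ a + suc (suc b) × h (suc x) < h x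
    widen {x} (a+1<x , x< , desc) = <⇒≤ a+1<x , subst (suc x ≤_) (sym (+-suc a (suc b))) x< , desc
    cases : (∀ {x} → x ∈ descAux (suc (suc a)) (map h (interval (suc a) (suc b))) → suc a < x × suc x ≤ suc a + suc b × h (suc x) < h x) →
      ∀ d → Reflects (h (suc (suc a)) < h (suc a)) d →
      x ∈ (if d then [ suc a ] else []) ++ descAux (suc (suc a)) (map h (interval (suc a) (suc b))) →
      a < x × suc x ≤ a + suc (suc b) × h (suc x) < h x
    cases _ true (ofʸ desc) (here refl) = ≤-refl , ≤-trans (m≤m+n (suc (suc a)) b) (≤-reflexive (sym (trans (+-suc a (suc b)) (cong suc (+-suc a b))))) , desc
    cases ih true _ (there x∈′) = widen (ih x∈′)
    cases ih false _ x∈′ = widen (ih x∈′)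

∈-descAux-interval⁺ : ∀ (h : ℕ → ℕ) a b {x} → a < x → suc x ≤ a + b → h (suc x) < h x →
  x ∈ descAux (suc a) (map h (interval a b))
∈-descAux-interval⁺ h a zero {x} a<x x< _ = ⊥-elim (<⇒≱ (≤-trans a<x (≤-trans (n≤1+n x) x<)) (≤-reflexive (+-identityʳ a)))
∈-descAux-interval⁺ h a (suc zero) {x} a<x x< _ = ⊥-elim (<⇒≱ (≤-trans (s≤s a<x) x<) (≤-reflexive (+-comm a 1)))
∈-descAux-interval⁺ h a (suc (suc b)) {x} a<x x< desc =
  cases _ (<ᵇ-reflects-< (h (suc (suc a))) (h (suc a))) (x ≟ suc a)
        (λ x≢a+1 → ∈-descAux-interval⁺ h (suc a) (suc b) (≤∧≢⇒< a<x (x≢a+1 ∘ sym)) (subst (suc x ≤_) (+-suc a (suc b)) x<) desc)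
  where
    cases : ∀ d → Reflects (h (suc (suc a)) < h (suc a)) d → Dec (x ≡ suc a) →
      (x ≢ suc a → x ∈ descAux (suc (suc a)) (map h (interval (suc a) (suc b)))) →
      x ∈ (if d then [ suc a ] else []) ++ descAux (suc (suc a)) (map h (interval (suc a) (suc b)))
    cases true  _           (yes refl)  _     = here refl
    cases false (ofⁿ ¬desc) (yes refl)  _     = ⊥-elim (¬desc desc)
    cases true  _           (no x≢a+1) later = there (later x≢a+1)
    cases false _           (no x≢a+1) later = later x≢a+1

foldr-⊔-≡ : ∀ (D : List ℕ) c → (∀ {x} → x ∈ D → x ≤ c) → c ≡ 0 ⊎ c ∈ D → foldr _⊔_ 0 D ≡ c
foldr-⊔-≡ D c upper attained = ≤-antisym (lub D upper) (lower attained)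
  where
    lub : ∀ D → (∀ {x} → x ∈ D → x ≤ c) → foldr _⊔_ 0 D ≤ c
    lub [] _ = z≤n
    lub (x ∷ D) ≤c = ⊔-lub (≤c (here refl)) (lub D (≤c ∘ there))
    ub : ∀ D {y} → y ∈ D → y ≤ foldr _⊔_ 0 D
    ub (x ∷ D) (here refl) = m≤m⊔n x _
    ub (x ∷ D) (there y∈) = ≤-trans (ub D y∈) (m≤n⊔m x _)
    lower : c ≡ 0 ⊎ c ∈ D → c ≤ foldr _⊔_ 0 D
    lower (inj₁ refl) = z≤n
    lower (inj₂ c∈) = ub D c∈

-- ldes(τ⁻¹) is the largest i such that i + 1 precedes i in τ.
ldes-inverse≡lastNonMax : ∀ n τ → Perm n τ → Avoids321From 0 0 τ → ldes (inverse n τ) ≡ lastNonMax 0 0 τ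
ldes-inverse≡lastNonMax n τ p a =
  trans (cong (λ r → foldr _⊔_ 0 (descAux 1 (map h r))) (range≡interval n)) (foldr-⊔-≡ _ c upper attained)
  where
    h : ℕ → ℕ
    h v = suc (pos v τ)
    c = lastNonMax 0 0 τ
    upper : ∀ {x} → x ∈ descAux 1 (map h (interval 0 n)) → x ≤ c
    upper {x} x∈ with ∈-descAux-interval⁻ h 0 n x∈ | x ≤? c
    ... | _ , _ , _ | yes x≤c = x≤c
    ... | 0<x , x<n , desc | no x≰c = ⊥-elim (<-asym (s≤s⁻¹ desc)
          (pos-increasing-above-lastNonMax 0 0 τ a (Perm⇒Distinct p) (Perm-∋ p 0<x (≤-trans (n≤1+n x) x<n))
            (Perm-∋ p (s≤s z≤n) x<n) (≰⇒> x≰c) (n<1+n x)))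
    attained : c ≡ 0 ⊎ c ∈ descAux 1 (map h (interval 0 n))
    attained with lastNonMax-initial⊎∈ 0 0 τ | c ≟ 0
    ... | inj₁ c≡0 | _ = inj₁ c≡0
    ... | inj₂ _ | yes c≡0 = inj₁ c≡0
    ... | inj₂ (c∈ , c<max) | no c≢0 = inj₂ (∈-descAux-interval⁺ h 0 n (proj₁ (Perm-∈⇒bounds p c∈)) c<n
          (s≤s (pos-suc-lastNonMax-< 0 0 τ a (Perm⇒Distinct p) (λ 0∈ → 1+n≰n (proj₁ (Perm-∈⇒bounds p 0∈))) c≢0 (Perm-∋ p (s≤s z≤n) c<n))))
      where
        c<n : suc c ≤ n
        c<n = <-≤-trans c<max (scanMax-lub 0 τ z≤n (Perm⇒All≤ p))

-- Block numbers

blockCount : ℕ → ℕ → List ℕ → ℕ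
blockCount i m [] = 0
blockCount i m (x ∷ l) = if (m ⊔ x) ≤ᵇ i then suc (blockCount (suc i) (m ⊔ x) l) else blockCount (suc i) (m ⊔ x) l

isBlockEnd : List ℕ → ℕ → Bool
isBlockEnd π i = allᵇ (λ x → x ≤ᵇ i) (take i π)

⊔-≤ᵇ : ∀ a b i → ((a ⊔ b) ≤ᵇ i) ≡ ((a ≤ᵇ i) ∧ (b ≤ᵇ i))
⊔-≤ᵇ a b i with a ≤ᵇ i | ≤ᵇ-view a i | b ≤ᵇ i | ≤ᵇ-view b i | (a ⊔ b) ≤ᵇ i | ≤ᵇ-view (a ⊔ b) i
... | true  | _       | true  | _       | true  | _        = refl
... | true  | is≤ a≤i | true  | is≤ b≤i | false | is> i<a⊔b = ⊥-elim (<⇒≱ i<a⊔b (⊔-lub a≤i b≤i))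
... | true  | _       | false | is> i<b | true  | is≤ a⊔b≤i = ⊥-elim (<⇒≱ i<b (≤-trans (m≤n⊔m a b) a⊔b≤i))
... | true  | _       | false | _       | false | _        = refl
... | false | is> i<a | _     | _       | true  | is≤ a⊔b≤i = ⊥-elim (<⇒≱ i<a (≤-trans (m≤m⊔n a b) a⊔b≤i))
... | false | _       | _     | _       | false | _        = refl

allᵇ-≤ᵇ : ∀ i L → allᵇ (λ x → x ≤ᵇ i) L ≡ (foldr _⊔_ 0 L ≤ᵇ i)
allᵇ-≤ᵇ i [] = refl
allᵇ-≤ᵇ i (x ∷ L) = trans (cong ((x ≤ᵇ i) ∧_) (allᵇ-≤ᵇ i L)) (sym (⊔-≤ᵇ x (foldr _⊔_ 0 L) i))

foldr-⊔-∷ʳ : ∀ P x → foldr _⊔_ 0 (P ∷ʳ x) ≡ foldr _⊔_ 0 P ⊔ x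
foldr-⊔-∷ʳ [] x = ⊔-identityʳ x
foldr-⊔-∷ʳ (y ∷ P) x = trans (cong (y ⊔_) (foldr-⊔-∷ʳ P x)) (sym (⊔-assoc y (foldr _⊔_ 0 P) x))

take-suc-length : ∀ (P : List ℕ) x l → take (suc (length P)) (P ++ x ∷ l) ≡ P ∷ʳ x
take-suc-length [] x l = refl
take-suc-length (y ∷ P) x l = cong (y ∷_) (take-suc-length P x l)

length-filterᵇ-∷ : ∀ (p : ℕ → Bool) y ys →
  length (filterᵇ p (y ∷ ys)) ≡ (if p y then suc (length (filterᵇ p ys)) else length (filterᵇ p ys))
length-filterᵇ-∷ p y ys with p y
... | true  = refl
... | false = refl

blockEnds≡blockCount : ∀ P l →
  length (filterᵇ (isBlockEnd (P ++ l)) (interval (length P) (length l))) ≡ blockCount (suc (length P)) (foldr _⊔_ 0 P) l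
blockEnds≡blockCount P [] = refl
blockEnds≡blockCount P (x ∷ l) = begin
  length (filterᵇ (isBlockEnd π) (suc (length P) ∷ rest))
    ≡⟨ length-filterᵇ-∷ (isBlockEnd π) (suc (length P)) rest ⟩
  (if isBlockEnd π (suc (length P)) then suc (count rest) else count rest)
    ≡⟨ cong (λ b → if b then suc (count rest) else count rest) isBlockEnd-next ⟩
  (if (M ⊔ x) ≤ᵇ suc (length P) then suc (count rest) else count rest)
    ≡⟨ cong (λ k → if (M ⊔ x) ≤ᵇ suc (length P) then suc k else k) later ⟩
  blockCount (suc (length P)) M (x ∷ l) ∎
  where
    open ≡-Reasoning
    π = P ++ x ∷ l
    M = foldr _⊔_ 0 P
    rest = interval (suc (length P)) (length l)
    count = λ is → length (filterᵇ (isBlockEnd π) is)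
    isBlockEnd-next : isBlockEnd π (suc (length P)) ≡ ((M ⊔ x) ≤ᵇ suc (length P))
    isBlockEnd-next = trans (cong (allᵇ (λ y → y ≤ᵇ suc (length P))) (take-suc-length P x l))
      (trans (allᵇ-≤ᵇ (suc (length P)) (P ∷ʳ x)) (cong (_≤ᵇ suc (length P)) (foldr-⊔-∷ʳ P x)))
    later : count rest ≡ blockCount (suc (suc (length P))) (M ⊔ x) l
    later with ih ← blockEnds≡blockCount (P ∷ʳ x) l
      rewrite ++-assoc P [ x ] l | length-∷ʳ P x | foldr-⊔-∷ʳ P x = ih

bl≡blockCount : ∀ π → bl π ≡ blockCount 1 0 π
bl≡blockCount π = trans (cong (λ r → length (filterᵇ (isBlockEnd π) r)) (range≡interval (length π))) (blockEnds≡blockCount [] π)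

blockCount-++ : ∀ i m X Y → blockCount i m (X ++ Y) ≡ blockCount i m X + blockCount (i + length X) (foldl _⊔_ m X) Y
blockCount-++ i m [] Y = cong (λ j → blockCount j m Y) (sym (+-identityʳ i))
blockCount-++ i m (x ∷ X) Y rewrite blockCount-++ (suc i) (m ⊔ x) X Y | +-suc i (length X) with (m ⊔ x) ≤ᵇ i
... | true  = refl
... | false = refl

blockCount-≤-length : ∀ i m l → blockCount i m l ≤ length l
blockCount-≤-length i m [] = z≤n
blockCount-≤-length i m (x ∷ l) with (m ⊔ x) ≤ᵇ i
... | true  = s≤s (blockCount-≤-length (suc i) (m ⊔ x) l)
... | false = m≤n⇒m≤1+n (blockCount-≤-length (suc i) (m ⊔ x) l)

foldl-⊔-lub : ∀ m X {b} → m ≤ b → All (_≤ b) X → foldl _⊔_ m X ≤ b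
foldl-⊔-lub m [] m≤b _ = m≤b
foldl-⊔-lub m (x ∷ X) m≤b (x≤b ∷ X≤b) = foldl-⊔-lub (m ⊔ x) X (⊔-lub m≤b x≤b) X≤b

foldl-⊔-≥ : ∀ m X → m ≤ foldl _⊔_ m X
foldl-⊔-≥ m [] = ≤-refl
foldl-⊔-≥ m (x ∷ X) = ≤-trans (m≤m⊔n m x) (foldl-⊔-≥ (m ⊔ x) X)

∈⇒≤foldl-⊔ : ∀ m X {y} → y ∈ X → y ≤ foldl _⊔_ m X
∈⇒≤foldl-⊔ m (x ∷ X) (here refl) = ≤-trans (m≤n⊔m m x) (foldl-⊔-≥ (m ⊔ x) X)
∈⇒≤foldl-⊔ m (x ∷ X) (there y∈) = ∈⇒≤foldl-⊔ (m ⊔ x) X y∈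

blockCount-lastBlock : ∀ i m y B {M} → m ⊔ y ≡ M → All (_≤ M) B → i + length B ≡ M → blockCount i m (y ∷ B) ≡ 1
blockCount-lastBlock i m y [] {M} refl [] i+0≡M with (m ⊔ y) ≤ᵇ i | ≤ᵇ-view (m ⊔ y) i
... | true  | _       = refl
... | false | is> i<M = ⊥-elim (<-irrefl (trans (sym (+-identityʳ i)) i+0≡M) i<M)
blockCount-lastBlock i m y (z ∷ B) {M} refl (z≤M ∷ B≤M) i+|B|≡M with (m ⊔ y) ≤ᵇ i | ≤ᵇ-view (m ⊔ y) i
... | true  | is≤ M≤i = ⊥-elim (<⇒≱ (subst (i <_) i+|B|≡M (m<m+n i (s≤s z≤n))) M≤i)
... | false | _       = blockCount-lastBlock (suc i) (m ⊔ y) z B (m≥n⇒m⊔n≡m z≤M) B≤M (trans (sym (+-suc i (length B))) i+|B|≡M)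

blockCount-++-lastBlock : ∀ A y B {M} → foldl _⊔_ 0 A ⊔ y ≡ M → All (_≤ M) B → suc (length A + length B) ≡ M →
  blockCount 1 0 (A ++ y ∷ B) ≡ suc (blockCount 1 0 A)
blockCount-++-lastBlock A y B max≡ B≤M |π|≡M =
  trans (blockCount-++ 1 0 A (y ∷ B)) (trans (cong (blockCount 1 0 A +_) (blockCount-lastBlock _ _ y B max≡ B≤M |π|≡M)) (+-comm _ 1))

foldl-⊔-Perm : ∀ {N l} → Perm (suc N) l → foldl _⊔_ 0 l ≡ suc N
foldl-⊔-Perm p = ≤-antisym (foldl-⊔-lub 0 _ z≤n (Perm⇒All≤ p)) (∈⇒≤foldl-⊔ 0 _ (Perm-∋max p (λ ())))

-- The last position of a permutation always ends a block.
blockCount-Perm-pos : ∀ {N l} → Perm (suc N) l → 1 ≤ blockCount 1 0 l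
blockCount-Perm-pos {N} {l} p with initLast l | Perm⇒length p
... | I ∷ʳ′ x | |l|≡ = subst (1 ≤_) (sym (blockCount-++-lastBlock I x [] max≡ [] (trans (cong suc (+-identityʳ _)) (trans (sym (length-∷ʳ I x)) |l|≡)))) (s≤s z≤n)
  where max≡ = trans (sym (foldl-∷ʳ _⊔_ 0 x I)) (foldl-⊔-Perm p)

blockCount-Perm-≤ : ∀ {n l} → Perm n l → blockCount 1 0 l ≤ n
blockCount-Perm-≤ {l = l} p = subst (blockCount 1 0 l ≤_) (Perm⇒length p) (blockCount-≤-length 1 0 l)

-- The three cases of the recursion

-- Bl and L of the statement, expressed through the scan (see Bl⇒InBl and L⇒InL).
Avoiding : ℕ → List ℕ → Set
Avoiding n π = Perm n π × Avoids321From 0 0 π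

InBl : ℕ → ℕ → List ℕ → Set
InBl n k π = Avoiding n π × blockCount 1 0 π ≡ k

InL : ℕ → ℕ → List ℕ → Set
InL n c τ = Avoiding n τ × lastNonMax 0 0 τ ≡ c

module Step (m : ℕ) where

  N = suc m
  n = suc N

  record AroundMax (A B : List ℕ) : Set where
    field
      n∉A : n ∉ A
      n∉B : n ∉ B
      A<n : All (_< n) A
      B<n : All (_< n) B
      scanMax≤n : scanMax 0 A ≤ n
      reduced : Perm N (A ++ B)
      lengths : length A + length B ≡ N

  aroundMax : ∀ A B → Perm n (A ++ n ∷ B) → AroundMax A B
  aroundMax A B p = record
    { n∉A = n∉A ; n∉B = n∉B
    ; A<n = A<n ; B<n = All.tabulate (λ y∈ → Perm-≢max⇒< p (∈-++⁺ʳ A (there y∈)) λ { refl → n∉B y∈ })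
    ; scanMax≤n = scanMax-lub 0 A z≤n (All.map <⇒≤ A<n)
    ; reduced = Perm-insert⁻ A B p
    ; lengths = trans (sym (length-++ A)) (Perm⇒length (Perm-insert⁻ A B p)) }
    where
      n∉A = proj₁ (Distinct-mid⁻ A n B (Perm⇒Distinct p))
      n∉B = proj₁ (proj₂ (Distinct-mid⁻ A n B (Perm⇒Distinct p)))
      A<n = All.tabulate (λ y∈ → Perm-≢max⇒< p (∈-++⁺ˡ y∈) λ { refl → n∉A y∈ })

  data Shape (π : List ℕ) : Set where
    caseA : ∀ A → π ≡ A ∷ʳ n → Shape π
    caseB : ∀ A b B → π ≡ A ++ n ∷ b ∷ B → N ∈ A → Shape π
    caseC : ∀ A B → π ≡ A ++ n ∷ B ++ [ N ] → Shape π

  -- After n the letters ascend (321-avoidance), so if N comes after n it comes last.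
  shape : ∀ π → Perm n π → Avoids321From 0 0 π → Shape π
  shape π p a with ∈-∃++ (Perm-∋max p (λ ()))
  ... | A , [] , refl = caseA A refl
  ... | A , b ∷ B , refl with ∈-++⁻ A (Perm-∋ p (s≤s z≤n) (n≤1+n N))
  ...   | inj₁ N∈A = caseB A b B refl N∈A
  ...   | inj₂ (here N≡n) = ⊥-elim (1+n≢n (sym N≡n))
  ...   | inj₂ (there N∈) with Ascending-max-last _ (b ∷ B) (proj₂ (Avoids321-maxRun⁻ a))
                               (proj₁ (proj₂ (Distinct-++⁻ A (b ∷ B) (Perm⇒Distinct reduced)))) N∈ (All.map s≤s⁻¹ B<n)
    where open AroundMax (aroundMax A (b ∷ B) p)
          open MaxRun A scanMax≤n B<n
  ...     | B′ , eq = caseC A B′ (cong (λ T → A ++ n ∷ T) eq)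

  f-caseA : ∀ A → Perm n (A ∷ʳ n) → f n (A ∷ʳ n) ≡ f N A ∷ʳ n
  f-caseA A p = begin
    f n (A ∷ʳ n)                   ≡⟨ if-cong (det (≡ᵇ-reflects-≡ _ _) (ofʸ pos-n≡N)) ⟩
    f N (remove n (A ∷ʳ n)) ∷ʳ n   ≡⟨ cong (λ σ → f N σ ∷ʳ n) (trans (remove-insert n A [] n∉A (λ ())) (++-identityʳ A)) ⟩
    f N A ∷ʳ n                     ∎
    where
      open ≡-Reasoning
      n∉A = AroundMax.n∉A (aroundMax A [] p)
      pos-n≡N : pos n (A ∷ʳ n) ≡ N
      pos-n≡N = trans (pos-insert n A [] n∉A) (suc-injective (trans (sym (length-∷ʳ A n)) (Perm⇒length p)))

  f-caseB : ∀ A b B {k} → Perm n (A ++ n ∷ b ∷ B) → N ∈ A → blockCount 1 0 (A ++ n ∷ b ∷ B) ≡ k →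
    f n (A ++ n ∷ b ∷ B) ≡ transp (n ∸ k ∸ 1) (n ∸ k) (insertAt (length A) n (f N (A ++ b ∷ B)))
  f-caseB A b B {k} p N∈A blocks≡k = begin
    f n π ≡⟨ if-cong (det (≡ᵇ-reflects-≡ _ _) (ofⁿ (<⇒≢ |A|<N ∘ trans (sym pos-n≡|A|)))) ⟩
    _     ≡⟨ if-cong (det (<ᵇ-reflects-< _ _) (ofʸ (subst (pos N π <_) (sym pos-n≡|A|) (pos-∈-< N A (n ∷ b ∷ B) N∈A)))) ⟩
    transp (n ∸ bl π ∸ 1) (n ∸ bl π) (insertAt (pos n π) n (f N (remove n π)))
      ≡⟨ cong₂ (λ k′ i → transp (n ∸ k′ ∸ 1) (n ∸ k′) (insertAt i n (f N (remove n π)))) (trans (bl≡blockCount π) blocks≡k) pos-n≡|A| ⟩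
    transp (n ∸ k ∸ 1) (n ∸ k) (insertAt (length A) n (f N (remove n π)))
      ≡⟨ cong (λ σ → transp (n ∸ k ∸ 1) (n ∸ k) (insertAt (length A) n (f N σ))) (remove-insert n A (b ∷ B) n∉A n∉B) ⟩
    transp (n ∸ k ∸ 1) (n ∸ k) (insertAt (length A) n (f N (A ++ b ∷ B))) ∎
    where
      open ≡-Reasoning
      open AroundMax (aroundMax A (b ∷ B) p)
      π = A ++ n ∷ b ∷ B
      pos-n≡|A| : pos n π ≡ length A
      pos-n≡|A| = pos-insert n A (b ∷ B) n∉A
      |A|<N : length A < N
      |A|<N = subst (length A <_) lengths (m<m+n (length A) (s≤s z≤n))

  record CaseCFacts (A B : List ℕ) : Set where
    field
      N∉A : N ∉ A
      n∉A : n ∉ A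
      N∉B : N ∉ B
      n∉B : n ∉ B

  caseCFacts : ∀ A B → Perm n (A ++ n ∷ B ++ [ N ]) → CaseCFacts A B
  caseCFacts A B p = record
    { N∉A = λ N∈A → proj₂ (proj₂ (Distinct-++⁻ A (B ++ [ N ]) d′)) N∈A (∈-++⁺ʳ B (here refl))
    ; n∉A = n∉A
    ; N∉B = λ N∈B → proj₂ (proj₂ (Distinct-++⁻ B [ N ] (proj₁ (proj₂ (Distinct-++⁻ A (B ++ [ N ]) d′))))) N∈B (here refl)
    ; n∉B = n∉B ∘ ∈-++⁺ˡ }
    where
      open AroundMax (aroundMax A (B ++ [ N ]) p)
      d′ = Perm⇒Distinct reduced

  tₙ = transpVal N n

  module _ {A B : List ℕ} (facts : CaseCFacts A B) where
    open CaseCFacts facts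

    private
      transp-fixed : ∀ {L} → N ∉ L → n ∉ L → map tₙ L ≡ L
      transp-fixed {L} N∉ n∉ = map-id-local (All.tabulate λ {y} y∈ → transpVal-other N n y (λ { refl → N∉ y∈ }) (λ { refl → n∉ y∈ }))

    transp-N↦n : map tₙ (A ++ N ∷ B) ≡ A ++ n ∷ B
    transp-N↦n = trans (map-++ tₙ A (N ∷ B)) (cong₂ _++_ (transp-fixed N∉A n∉A) (cong₂ _∷_ (transpVal-a N n) (transp-fixed N∉B n∉B)))

    transp-n↦N : map tₙ (A ++ n ∷ B) ≡ A ++ N ∷ B
    transp-n↦N = trans (map-++ tₙ A (n ∷ B)) (cong₂ _++_ (transp-fixed N∉A n∉A) (cong₂ _∷_ (transpVal-b N n 1+n≢n) (transp-fixed N∉B n∉B)))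

    transp-caseC : map tₙ (A ++ n ∷ B ++ [ N ]) ≡ (A ++ N ∷ B) ∷ʳ n
    transp-caseC = begin
      map tₙ (A ++ n ∷ B ++ [ N ])             ≡⟨ map-++ tₙ A (n ∷ B ++ [ N ]) ⟩
      map tₙ A ++ tₙ n ∷ map tₙ (B ++ [ N ])     ≡⟨ cong₂ (λ X Y → X ++ tₙ n ∷ Y) (transp-fixed N∉A n∉A) (map-++ tₙ B [ N ]) ⟩
      A ++ tₙ n ∷ map tₙ B ++ [ tₙ N ]           ≡⟨ cong₂ (λ x Y → A ++ x ∷ Y ++ [ tₙ N ]) (transpVal-b N n 1+n≢n) (transp-fixed N∉B n∉B) ⟩
      A ++ N ∷ B ++ [ tₙ N ]                   ≡⟨ cong (λ x → A ++ N ∷ B ++ [ x ]) (transpVal-a N n) ⟩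
      A ++ N ∷ B ++ [ n ]                     ≡⟨ ++-assoc A (N ∷ B) [ n ] ⟨
      (A ++ N ∷ B) ∷ʳ n                       ∎
      where open ≡-Reasoning

  f-caseC : ∀ A B {k} → Perm n (A ++ n ∷ B ++ [ N ]) → blockCount 1 0 (A ++ n ∷ B ++ [ N ]) ≡ k →
    f n (A ++ n ∷ B ++ [ N ]) ≡ cyc (n ∸ k) n (f N (A ++ N ∷ B) ∷ʳ n)
  f-caseC A B {k} p blocks≡k = begin
    f n π   ≡⟨ if-cong (det (≡ᵇ-reflects-≡ _ _) (ofⁿ (|A|≢N ∘ trans (sym pos-n≡|A|)))) ⟩
    _       ≡⟨ if-cong (det (<ᵇ-reflects-< _ _) (ofⁿ pos-N≮pos-n)) ⟩
    cyc (n ∸ bl π) n (f N (remove n (map tₙ π)) ∷ʳ n)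
            ≡⟨ cong₂ (λ k′ σ → cyc (n ∸ k′) n (f N σ ∷ʳ n)) (trans (bl≡blockCount π) blocks≡k) removed ⟩
    cyc (n ∸ k) n (f N (A ++ N ∷ B) ∷ʳ n) ∎
    where
      open ≡-Reasoning
      facts = caseCFacts A B p
      open CaseCFacts facts
      π = A ++ n ∷ B ++ [ N ]
      pos-n≡|A| : pos n π ≡ length A
      pos-n≡|A| = pos-insert n A (B ++ [ N ]) n∉A
      |A|≢N : length A ≢ N
      |A|≢N = <⇒≢ (subst (length A <_) (AroundMax.lengths (aroundMax A (B ++ [ N ]) p))
        (m<m+n (length A) (subst (0 <_) (sym (length-∷ʳ B N)) (s≤s z≤n))))
      pos-N≮pos-n : ¬ (pos N π < pos n π)
      pos-N≮pos-n lt = <⇒≱ (subst (pos N π <_) pos-n≡|A| lt)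
        (subst (length A ≤_) (sym (pos-++ N A (n ∷ B ++ [ N ]) N∉A)) (m≤m+n (length A) _))
      removed : remove n (map tₙ π) ≡ A ++ N ∷ B
      removed = trans (cong (remove n) (transp-caseC facts))
        (trans (remove-insert n (A ++ N ∷ B) [] (λ n∈ → Sum.[ n∉A , (λ { (here n≡N) → 1+n≢n n≡N ; (there n∈B) → n∉B n∈B }) ] (∈-++⁻ A n∈)) (λ ()))
          (++-identityʳ _))

  blocks-caseA : ∀ A → Perm n (A ∷ʳ n) → blockCount 1 0 (A ∷ʳ n) ≡ suc (blockCount 1 0 A)
  blocks-caseA A p = blockCount-++-lastBlock A n [] (m≤n⇒m⊔n≡n (foldl-⊔-lub 0 A z≤n (All.map <⇒≤ A<n))) [] (cong suc lengths)
    where open AroundMax (aroundMax A [] p)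

  blocks-caseB : ∀ A b B → Perm n (A ++ n ∷ b ∷ B) → N ∈ A → blockCount 1 0 (A ++ n ∷ b ∷ B) ≡ blockCount 1 0 (A ++ b ∷ B)
  blocks-caseB A b B p N∈A = trans
    (blockCount-++-lastBlock A n (b ∷ B) (m≤n⇒m⊔n≡n (≤-trans (≤-reflexive max≡N) (n≤1+n N))) (All.map <⇒≤ B<n) (cong suc lengths))
    (sym (blockCount-++-lastBlock A b B (trans (cong (_⊔ b) max≡N) (m≥n⇒m⊔n≡m (s≤s⁻¹ (All.head B<n))))
      (All.map s≤s⁻¹ (All.tail B<n)) (trans (sym (+-suc (length A) (length B))) lengths)))
    where
      open AroundMax (aroundMax A (b ∷ B) p)
      max≡N : foldl _⊔_ 0 A ≡ N
      max≡N = ≤-antisym (foldl-⊔-lub 0 A z≤n (All.map s≤s⁻¹ A<n)) (∈⇒≤foldl-⊔ 0 A N∈A)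

  blocks-caseC : ∀ A B → Perm n (A ++ n ∷ B ++ [ N ]) → blockCount 1 0 (A ++ n ∷ B ++ [ N ]) ≡ blockCount 1 0 (A ++ N ∷ B)
  blocks-caseC A B p = trans
    (blockCount-++-lastBlock A n (B ++ [ N ]) (m≤n⇒m⊔n≡n (≤-trans max≤N (n≤1+n N))) (All.map <⇒≤ B<n) (cong suc lengths))
    (sym (blockCount-++-lastBlock A N B (m≤n⇒m⊔n≡n max≤N) (All.map s≤s⁻¹ (++⁻ˡ B B<n))
      (trans (sym (+-suc (length A) (length B))) (trans (cong (length A +_) (sym (length-∷ʳ B N))) lengths))))
    where
      open AroundMax (aroundMax A (B ++ [ N ]) p)
      max≤N : foldl _⊔_ 0 A ≤ N
      max≤N = foldl-⊔-lub 0 A z≤n (All.map s≤s⁻¹ A<n)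

module Reduce (m : ℕ) where
  open Step m

  reduce-caseA : ∀ A → Avoiding n (A ∷ʳ n) → Avoiding N A
  reduce-caseA A (p , a) = Perm-∷ʳ⁻ A p , NewMax.Avoids321-newMax⁻ A (AroundMax.scanMax≤n (aroundMax A [] p)) a

  extend-caseA : ∀ A → Avoiding N A → Avoiding n (A ∷ʳ n)
  extend-caseA A (p , a) = Perm-∷ʳ⁺ A p , NewMax.Avoids321-newMax⁺ A (≤-trans (≤-reflexive (scanMax-Perm p (λ ()))) (n≤1+n N)) a

  caseB-run : ∀ A B → Perm n (A ++ n ∷ B) → N ∈ A → scanMax 0 A ≡ N × All (_< scanMax 0 A) B
  caseB-run A B p N∈A = max≡N , All.tabulate (λ y∈ → subst (_ <_) (sym max≡N) (≤∧≢⇒< (s≤s⁻¹ (All.lookup B<n y∈)) λ { refl → N∉B y∈ }))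
    where
      open AroundMax (aroundMax A B p)
      max≡N : scanMax 0 A ≡ N
      max≡N = ≤-antisym (scanMax-lub 0 A z≤n (All.map s≤s⁻¹ A<n)) (∈⇒≤scanMax 0 A N∈A)
      N∉B : N ∉ B
      N∉B N∈B = proj₂ (proj₂ (Distinct-++⁻ A B (Perm⇒Distinct reduced))) N∈A N∈B

  reduce-caseB : ∀ A B → N ∈ A → Avoiding n (A ++ n ∷ B) → Avoiding N (A ++ B)
  reduce-caseB A B N∈A (p , a) = AroundMax.reduced (aroundMax A B p) ,
    InsertMax.Avoids321-insertMax⁻ A (AroundMax.scanMax≤n (aroundMax A B p)) (proj₂ (caseB-run A B p N∈A)) a

  extend-caseB : ∀ X Y → All (_< scanMax 0 X) Y → Avoiding N (X ++ Y) → Avoiding n (X ++ n ∷ Y)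
  extend-caseB X Y Y<max (p , a) = Perm-insert⁺ X Y p , InsertMax.Avoids321-insertMax⁺ X X≤n Y<max a
    where X≤n = scanMax-lub 0 X z≤n (All.tabulate λ x∈ → ≤-trans (Perm-∈⇒≤ p (∈-++⁺ˡ x∈)) (n≤1+n N))

  caseCFacts-reduced : ∀ A B → Perm N (A ++ N ∷ B) → CaseCFacts A B
  caseCFacts-reduced A B p = record
    { N∉A = proj₁ (Distinct-mid⁻ A N B (Perm⇒Distinct p))
    ; n∉A = λ n∈A → 1+n≰n (Perm-∈⇒≤ p (∈-++⁺ˡ n∈A))
    ; N∉B = proj₁ (proj₂ (Distinct-mid⁻ A N B (Perm⇒Distinct p)))
    ; n∉B = λ n∈B → 1+n≰n (Perm-∈⇒≤ p (∈-++⁺ʳ A (there n∈B))) }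

  private
    tₙ-perm : map tₙ (interval 0 n) ↭ interval 0 n
    tₙ-perm = transp-permutes-interval N n (s≤s z≤n) ≤-refl
    t0≡0 : tₙ 0 ≡ 0
    t0≡0 = transpVal-other N n 0 (λ ()) (λ ())

  module _ (A B : List ℕ) (p : Perm n (A ++ n ∷ B ++ [ N ])) where
    private
      facts = caseCFacts A B p
      open CaseCFacts facts
      πA = A ++ n ∷ B
      ≢N : All (_≢ N) πA
      ≢N = All.tabulate λ y∈ → λ { refl → Sum.[ N∉A , (λ { (here N≡n) → 1+n≢n (sym N≡n) ; (there N∈B) → N∉B N∈B }) ] (∈-++⁻ A y∈) }
      open Relabel.FromZero tₙ (_≢ N) (transpVal-strictMono-≢a N) (λ ()) t0≡0 ≢N
      assoc = ++-assoc A (n ∷ B) [ N ]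

    reduce-caseC : Avoids321From 0 0 (A ++ n ∷ B ++ [ N ]) → Avoiding N (A ++ N ∷ B)
    reduce-caseC a = Perm-∷ʳ⁻ (A ++ N ∷ B) (subst (Perm n) (transp-caseC facts) (Perm-map tₙ tₙ-perm p)) ,
      subst (Avoids321From 0 0) (transp-n↦N facts) (Avoids321From-map₀ (proj₁ (Avoids321From-++⁻ 0 0 πA [ N ] (subst (Avoids321From 0 0) (sym assoc) a))))

    ltrMask-caseC : ltrMask 0 (A ++ n ∷ B ++ [ N ]) ≡ ltrMask 0 (A ++ N ∷ B) ∷ʳ false
    ltrMask-caseC = begin
      ltrMask 0 (A ++ n ∷ B ++ [ N ])   ≡⟨ cong (ltrMask 0) (sym assoc) ⟩
      ltrMask 0 (πA ∷ʳ N)               ≡⟨ Run.ltrMask-run πA (N<max ∷ []) ⟩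
      ltrMask 0 πA ∷ʳ false             ≡⟨ cong (λ M → M ∷ʳ false) (trans (sym ltrMask-map₀) (cong (ltrMask 0) (transp-n↦N facts))) ⟩
      ltrMask 0 (A ++ N ∷ B) ∷ʳ false   ∎
      where
        open ≡-Reasoning
        N<max : N < scanMax 0 πA
        N<max = ∈⇒≤scanMax 0 πA (∈-++⁺ʳ A (here refl))

  extend-caseC : ∀ A B → Avoiding N (A ++ N ∷ B) → Avoiding n (A ++ n ∷ B ++ [ N ])
  extend-caseC A B (p , a) =
    subst (Perm n) (trans (map-++ tₙ _ [ n ]) (trans (cong₂ _++_ (transp-N↦n facts) (cong [_] (transpVal-b N n 1+n≢n))) (++-assoc A (n ∷ B) [ N ])))
      (Perm-map tₙ tₙ-perm (Perm-∷ʳ⁺ (A ++ N ∷ B) p)) ,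
    subst (Avoids321From 0 0) (++-assoc A (n ∷ B) [ N ]) (Run.Avoids321-run⁺ πA (N<max ∷ []) aπA (lastNonMax≤N , tt))
    where
      facts = caseCFacts-reduced A B p
      open CaseCFacts facts
      πA = A ++ n ∷ B
      ≢n : All (_≢ n) (A ++ N ∷ B)
      ≢n = All.tabulate λ y∈ → λ { refl → 1+n≰n (Perm-∈⇒≤ p y∈) }
      open Relabel.FromZero tₙ (_≢ n) (transpVal-strictMono-≢b N) (λ ()) t0≡0 ≢n
      aπA : Avoids321From 0 0 πA
      aπA = subst (Avoids321From 0 0) (transp-N↦n facts) (Avoids321From-map₀ a)
      N<max : N < scanMax 0 πA
      N<max = ∈⇒≤scanMax 0 πA (∈-++⁺ʳ A (here refl))
      lastNonMax≤N : lastNonMax 0 0 πA ≤ N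
      lastNonMax≤N = subst (_≤ N) (trans (sym (transpVal-other N n _ (λ c≡N → 1+n≰n (subst (_≤ m) c≡N c≤m)) (λ c≡n → 1+n≰n (≤-trans (subst (_≤ m) c≡n c≤m) (n≤1+n m)))))
                                           (trans (sym lastNonMax-map₀) (cong (lastNonMax 0 0) (transp-N↦n facts))))
                      (≤-trans c≤m (n≤1+n m))
        where c≤m = lastNonMax-Perm p

-- Case B swaps the letters c and c + 1; on the words involved this is a bijection between
-- X ++ Z ∷ʳ c (c the last non-maximum) and t X ++ n ∷ Z ∷ʳ (c + 1).
module CaseB (m c : ℕ) (1≤c : 1 ≤ c) (c≤m : c ≤ m) where
  open Step m

  t = transpVal c (suc c)

  private
    c<N : c < N
    c<N = s≤s c≤m
    c<n : c < n
    c<n = ≤-trans c<N (n≤1+n N)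
    t0≡0 : t 0 ≡ 0
    t0≡0 = transpVal-other c (suc c) 0 (λ 0≡c → <⇒≢ 1≤c 0≡c) (λ ())
    t-below : ∀ {y} → y < c → t y ≡ y
    t-below y<c = transpVal-other c (suc c) _ (<⇒≢ y<c) (<⇒≢ (≤-trans y<c (n≤1+n c)))
    tn≡n : t n ≡ n
    tn≡n = transpVal-other c (suc c) n (λ n≡c → <⇒≢ c<n (sym n≡c)) (λ n≡c+1 → <⇒≢ (s≤s c<N) (sym n≡c+1))

  transp-caseB : ∀ Y Z → All (_< c) Z → map t (Y ++ n ∷ Z ∷ʳ c) ≡ map t Y ++ n ∷ Z ∷ʳ suc c
  transp-caseB Y Z Z<c = begin
    map t (Y ++ n ∷ Z ∷ʳ c)           ≡⟨ map-++ t Y (n ∷ Z ∷ʳ c) ⟩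
    map t Y ++ t n ∷ map t (Z ∷ʳ c)   ≡⟨ cong₂ (λ x W → map t Y ++ x ∷ W) tn≡n (map-++ t Z [ c ]) ⟩
    map t Y ++ n ∷ map t Z ∷ʳ t c     ≡⟨ cong₂ (λ W x → map t Y ++ n ∷ W ∷ʳ x) (map-id-local (All.map t-below Z<c)) (transpVal-a c (suc c)) ⟩
    map t Y ++ n ∷ Z ∷ʳ suc c         ∎
    where open ≡-Reasoning

  transp-caseB-reduced : ∀ Y Z → All (_< c) Z → map t (Y ++ Z ∷ʳ suc c) ≡ map t Y ++ Z ∷ʳ c
  transp-caseB-reduced Y Z Z<c = trans (map-++ t Y (Z ∷ʳ suc c)) (cong (map t Y ++_) (trans (map-++ t Z [ suc c ])
    (cong₂ _∷ʳ_ (map-id-local (All.map t-below Z<c)) (transpVal-b c (suc c) 1+n≢n))))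

  private
    lastOf<c : ∀ {u Z} → u < c → All (_< c) Z → lastOf u Z < c
    lastOf<c {u} {Z} u<c Z<c = Sum.[ (λ last≡u → subst (_< c) (sym last≡u) u<c) , All.lookup Z<c ]′ (lastOf-initial⊎∈ u Z)

  record Lifted (X Z : List ℕ) : Set where
    field
      inL : InL n (suc c) (map t X ++ n ∷ Z ∷ʳ suc c)
      mask : ltrMask 0 (map t X ++ n ∷ Z ∷ʳ suc c) ≡ ltrMask 0 X ++ true ∷ replicate (suc (length Z)) false
      before<c : lastNonMax 0 0 (map t X ++ n ∷ Z) < c
      Z<c : All (_< c) Z

  lift : ∀ X Z → All (_< scanMax 0 X) (Z ∷ʳ c) → InL N c (X ++ Z ∷ʳ c) → Lifted X Z
  lift X Z Z<max ((p , a) , last≡c) = record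
    { inL = (pτ , Avoids321-maxRun⁺ (Avoids321From-map₀ aX) (subst (λ v → Ascending v (Z ∷ʳ suc c)) (sym u′≡u) asc′)) ,
            trans lastNonMax-maxRun (trans (cong (λ v → lastOf v (Z ∷ʳ suc c)) u′≡u) (lastOf-∷ʳ u Z (suc c)))
    ; mask = trans ltrMask-maxRun (cong₂ (λ M r → M ++ true ∷ replicate r false) ltrMask-map₀ (length-∷ʳ Z (suc c)))
    ; before<c = subst (_< c) (sym (trans (MaxRun.lastNonMax-maxRun (map t X) tX≤n (All.map (λ z<c → <-trans z<c c<n) Z<c)) (cong (λ v → lastOf v Z) u′≡u)))
                   (lastOf<c u<c Z<c)
    ; Z<c = Z<c }
    where
      open Run X Z<max
      aX = proj₁ (Avoids321-run⁻ a)
      asc = proj₂ (Avoids321-run⁻ a)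
      u = lastNonMax 0 0 X
      d = Distinct-++⁻ X (Z ∷ʳ c) (Perm⇒Distinct p)
      c∉X : c ∉ X
      c∉X c∈X = proj₂ (proj₂ d) c∈X (∈-++⁺ʳ Z (here refl))
      Z≤c : All (_≤ c) Z
      Z≤c = subst (λ v → All (_≤ v) Z) (lastOf-∷ʳ u Z c) (++⁻ˡ Z (proj₂ (Ascending-≤lastOf u (Z ∷ʳ c) asc)))
      Z<c : All (_< c) Z
      Z<c = All.tabulate λ z∈ → ≤∧≢⇒< (All.lookup Z≤c z∈) λ { refl → proj₂ (proj₂ (Distinct-++⁻ Z [ c ] (proj₁ (proj₂ d)))) z∈ (here refl) }
      u<c : u < c
      u<c = ≤∧≢⇒< (subst (u ≤_) (lastOf-∷ʳ u Z c) (proj₁ (Ascending-≤lastOf u (Z ∷ʳ c) asc)))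
              (λ u≡c → Sum.[ (λ u≡0 → <⇒≢ 1≤c (sym (trans (sym u≡c) u≡0))) , (λ (u∈X , _) → c∉X (subst (_∈ X) u≡c u∈X)) ]′ (lastNonMax-initial⊎∈ 0 0 X))
      ≢c : All (_≢ c) X
      ≢c = All.tabulate λ y∈ → λ { refl → c∉X y∈ }
      open Relabel.FromZero t (_≢ c) (transpVal-strictMono-≢a c) (<⇒≢ 1≤c) t0≡0 ≢c
      u′≡u : lastNonMax 0 0 (map t X) ≡ u
      u′≡u = trans lastNonMax-map₀ (t-below u<c)
      pτ : Perm n (map t X ++ n ∷ Z ∷ʳ suc c)
      pτ = subst (Perm n) (transp-caseB X Z Z<c) (Perm-map t (transp-permutes-interval c n 1≤c c<n) (Perm-insert⁺ X (Z ∷ʳ c) p))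
      tX≤n : scanMax 0 (map t X) ≤ n
      tX≤n = scanMax-lub 0 (map t X) z≤n (All.tabulate λ y∈ → Perm-∈⇒≤ pτ (∈-++⁺ˡ y∈))
      Z+<n : All (_< n) (Z ∷ʳ suc c)
      Z+<n = All-++⁺ (All.map (λ z<c → <-trans z<c c<n) Z<c) (s≤s c<N ∷ [])
      asc′ : Ascending u (Z ∷ʳ suc c)
      asc′ = Ascending-replaceLast u Z c (suc c) asc (≤-trans (<⇒≤ (lastOf<c u<c Z<c)) (n≤1+n c))
      open MaxRun (map t X) tX≤n Z+<n

  record Lowered (X Z : List ℕ) : Set where
    field
      inL : InL N c (map t X ++ Z ∷ʳ c)
      Z<max : All (_< scanMax 0 (map t X)) (Z ∷ʳ c)
      Z<c : All (_< c) Z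

  lower : ∀ X Z → InL n (suc c) (X ++ n ∷ Z ∷ʳ suc c) → lastNonMax 0 0 (X ++ n ∷ Z) < c → Lowered X Z
  lower X Z ((p , a) , _) before<c = record
    { inL = (pσ , Run.Avoids321-run⁺ (map t X) Z+<max (Avoids321From-map₀ aX) (subst (λ v → Ascending v (Z ∷ʳ c)) (sym u′≡u) asc′)) ,
            trans (Run.lastNonMax-run (map t X) Z+<max) (trans (cong (λ v → lastOf v (Z ∷ʳ c)) u′≡u) (lastOf-∷ʳ u Z c))
    ; Z<max = Z+<max
    ; Z<c = Z<c }
    where
      open AroundMax (aroundMax X (Z ∷ʳ suc c) p)
      u = lastNonMax 0 0 X
      aX = proj₁ (MaxRun.Avoids321-maxRun⁻ X scanMax≤n B<n a)
      asc = proj₂ (MaxRun.Avoids321-maxRun⁻ X scanMax≤n B<n a)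
      lastOf-u-Z<c : lastOf u Z < c
      lastOf-u-Z<c = subst (_< c) (MaxRun.lastNonMax-maxRun X scanMax≤n (++⁻ˡ Z B<n)) before<c
      bounds = Ascending-≤lastOf u Z (Ascending-∷ʳ⁻ u Z asc)
      u<c : u < c
      u<c = ≤-<-trans (proj₁ bounds) lastOf-u-Z<c
      Z<c : All (_< c) Z
      Z<c = All.map (λ z≤ → ≤-<-trans z≤ lastOf-u-Z<c) (proj₂ bounds)
      d = Distinct-++⁻ X (Z ∷ʳ suc c) (Perm⇒Distinct reduced)
      c+1∉X : suc c ∉ X
      c+1∉X c+1∈X = proj₂ (proj₂ d) c+1∈X (∈-++⁺ʳ Z (here refl))
      c∈X : c ∈ X
      c∈X = Sum.[ id , (λ c∈ → ⊥-elim (Sum.[ (λ c∈Z → <-irrefl refl (All.lookup Z<c c∈Z)) , (λ { (here c≡c+1) → 1+n≢n (sym c≡c+1) }) ]′ (∈-++⁻ Z c∈))) ]′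
              (∈-++⁻ X (Perm-∋ reduced 1≤c (<⇒≤ c<N)))
      ≢c+1 : All (_≢ suc c) X
      ≢c+1 = All.tabulate λ y∈ → λ { refl → c+1∉X y∈ }
      open Relabel.FromZero t (_≢ suc c) (transpVal-strictMono-≢b c) (λ ()) t0≡0 ≢c+1
      u′≡u : lastNonMax 0 0 (map t X) ≡ u
      u′≡u = trans lastNonMax-map₀ (t-below u<c)
      pσ : Perm N (map t X ++ Z ∷ʳ c)
      pσ = subst (Perm N) (transp-caseB-reduced X Z Z<c) (Perm-map t (transp-permutes-interval c N 1≤c c<N) reduced)
      c+1≤max : suc c ≤ scanMax 0 (map t X)
      c+1≤max = subst (_≤ scanMax 0 (map t X)) (transpVal-a c (suc c)) (∈⇒≤scanMax 0 (map t X) (∈-map⁺ t c∈X))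
      Z+<max : All (_< scanMax 0 (map t X)) (Z ∷ʳ c)
      Z+<max = All-++⁺ (All.map (λ z<c → <-≤-trans (<-trans z<c (n<1+n c)) c+1≤max) Z<c) (c+1≤max ∷ [])
      asc′ : Ascending u (Z ∷ʳ c)
      asc′ = Ascending-replaceLast u Z (suc c) c asc (<⇒≤ lastOf-u-Z<c)

-- Case C rotates the letters c + 1, …, n by the cycle (c+1, …, n); ρ has last non-maximum c.
module CaseC (m c : ℕ) (c<N : c < suc m) where
  open Step m

  g = cycVal (suc c) n
  h = cycInvVal (suc c) n

  private
    c+1≤n : suc c ≤ n
    c+1≤n = ≤-trans c<N (n≤1+n N)

  record Lifted (ρ : List ℕ) : Set where
    field
      inL : InL n (suc c) (map g ρ ∷ʳ suc c)
      mask : ltrMask 0 (map g ρ ∷ʳ suc c) ≡ ltrMask 0 ρ ∷ʳ false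
      before≡c : lastNonMax 0 0 (map g ρ) ≡ c

  lift : ∀ ρ → InL N c ρ → Lifted ρ
  lift ρ ((p , a) , last≡c) = record
    { inL = (subst (Perm n) (trans (map-++ g ρ [ n ]) (cong (λ x → map g ρ ∷ʳ x) (cycVal-end (suc c) n c+1≤n)))
               (Perm-map g (cyc-permutes-interval (suc c) n (s≤s z≤n) c+1≤n) (Perm-∷ʳ⁺ ρ p))
           , Run.Avoids321-run⁺ (map g ρ) (c+1<max ∷ []) (Avoids321From-map₀ a) (≤-trans (≤-reflexive last′≡c) (n≤1+n c) , tt))
          , Run.lastNonMax-run (map g ρ) (c+1<max ∷ [])
    ; mask = trans (Run.ltrMask-run (map g ρ) (c+1<max ∷ [])) (cong (_∷ʳ false) ltrMask-map₀)
    ; before≡c = last′≡c }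
    where
      <n : All (_< n) ρ
      <n = All.map s≤s (Perm⇒All≤ p)
      open Relabel.FromZero g (_< n) (cycVal-strictMono (suc c) n c+1≤n) (s≤s z≤n) (cycVal-below (suc c) n 0 c+1≤n (s≤s z≤n)) <n
      last′≡c : lastNonMax 0 0 (map g ρ) ≡ c
      last′≡c = trans lastNonMax-map₀ (trans (cong g last≡c) (cycVal-below (suc c) n c c+1≤n ≤-refl))
      c+1<max : suc c < scanMax 0 (map g ρ)
      c+1<max = subst (suc c <_) (sym (trans scanMax-map₀ (trans (cong g (scanMax-Perm p (λ ()))) (cycVal-inside (suc c) n N c<N ≤-refl)))) (s≤s c<N)

  lower : ∀ I → InL n (suc c) (I ∷ʳ suc c) → lastNonMax 0 0 I ≡ c → InL N c (map h I)
  lower I ((p , a) , _) last≡c =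
    (Perm-∷ʳ⁻ (map h I) (subst (Perm n) (trans (map-++ h I [ suc c ]) (cong (λ x → map h I ∷ʳ x) (cycInvVal-start (suc c) n)))
       (Perm-map h (cycInv-permutes-interval (suc c) n (s≤s z≤n) c+1≤n) p))
    , Avoids321From-map₀ (proj₁ (Avoids321From-++⁻ 0 0 I [ suc c ] a)))
    , trans lastNonMax-map₀ (trans (cong h last≡c) (cycInvVal-below (suc c) n c ≤-refl))
    where
      c+1∉I : suc c ∉ I
      c+1∉I c+1∈I = proj₂ (proj₂ (Distinct-++⁻ I [ suc c ] (Perm⇒Distinct p))) c+1∈I (here refl)
      ≢c+1 : All (_≢ suc c) I
      ≢c+1 = All.tabulate λ y∈ → λ { refl → c+1∉I y∈ }
      open Relabel.FromZero h (_≢ suc c) (cycInvVal-strictMono (suc c) n c+1≤n) (λ ()) (cycInvVal-below (suc c) n 0 (s≤s z≤n)) ≢c+1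

record SplitAtMaxima (N : ℕ) (π′ W : List ℕ) (r : ℕ) : Set where
  field
    X′ : List ℕ
    y : ℕ
    Y : List ℕ
    π′≡ : π′ ≡ X′ ++ y ∷ Y
    |X′|≡ : length X′ ≡ length W
    maskX′ : ltrMask 0 X′ ≡ ltrMask 0 W
    |Y|≡ : length Y ≡ r
    Y<max : All (_< scanMax 0 X′) (y ∷ Y)
    N∈X′ : N ∈ X′

splitAtMaxima : ∀ {N π′} W r → Perm N π′ → N ≢ 0 → ltrMask 0 π′ ≡ ltrMask 0 W ++ replicate (suc r) false → SplitAtMaxima N π′ W r
splitAtMaxima {N} {π′} W r p N≢0 mask≡ with ∷-view (drop (length W) π′) (proj₂ (proj₂ (ltrMask-split π′ W (suc r) mask≡)))
... | y , Y , Y′≡ = record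
  { X′ = X′ ; y = y ; Y = Y ; π′≡ = π′≡ ; |X′|≡ = |X′|≡ ; maskX′ = proj₁ split
  ; |Y|≡ = suc-injective (trans (cong length (sym Y′≡)) (proj₂ (proj₂ split))) ; Y<max = Y<max
  ; N∈X′ = Sum.[ id , (λ N∈ → ⊥-elim (<⇒≱ (All.lookup Y<max N∈) (scanMax-lub 0 X′ z≤n X′≤N))) ]′ (∈-++⁻ X′ (subst (N ∈_) π′≡ (Perm-∋max p N≢0))) }
  where
    X′ = take (length W) π′
    split = ltrMask-split π′ W (suc r) mask≡
    π′≡ : π′ ≡ X′ ++ y ∷ Y
    π′≡ = trans (sym (take++drop≡id (length W) π′)) (cong (X′ ++_) Y′≡)
    |X′|≡ : length X′ ≡ length W
    |X′|≡ = trans (sym (length-ltrMask 0 X′)) (trans (cong length (proj₁ split)) (length-ltrMask 0 W))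
    Y<max : All (_< scanMax 0 X′) (y ∷ Y)
    Y<max = subst (All (_< scanMax 0 X′)) Y′≡ (proj₁ (proj₂ split))
    X′≤N : All (_≤ N) X′
    X′≤N = All.tabulate λ x∈ → Perm-∈⇒≤ p (subst (_ ∈_) (sym π′≡) (∈-++⁺ˡ x∈))

-- f maps Bl onto L

ForwardSpec : ℕ → ℕ → List ℕ → Set
ForwardSpec n k π = InL n (n ∸ k) (f n π) × ltrMask 0 (f n π) ≡ ltrMask 0 π

-- How f n π ends in cases B and C: with the letter n ∸ k, preceded by a word whose last
-- non-maximum is below, resp. equal to, n ∸ k ∸ 1.
EndsWith : (ℕ → ℕ → Set) → ℕ → ℕ → List ℕ → Set
EndsWith R n k τ = ∃ λ I → τ ≡ I ∷ʳ (n ∸ k) × R (lastNonMax 0 0 I) (n ∸ k ∸ 1)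

module Forward (m : ℕ) (ih : ∀ {k π} → InBl (suc m) k π → ForwardSpec (suc m) k π) where
  open Step m
  open Reduce m

  forward-caseA : ∀ A {k} → InBl n k (A ∷ʳ n) → ForwardSpec n k (A ∷ʳ n)
  forward-caseA A ((p , a) , refl) with ih (reduce-caseA A (p , a) , refl)
  ... | ((pσ , aσ) , lastσ) , maskσ rewrite f-caseA A p | blocks-caseA A p =
    ((Perm-∷ʳ⁺ σ pσ , Avoids321-newMax⁺ aσ) , trans lastNonMax-newMax lastσ) ,
    trans ltrMask-newMax (trans (cong (_∷ʳ true) maskσ) (sym (NewMax.ltrMask-newMax A (AroundMax.scanMax≤n (aroundMax A [] p)))))
    where
      σ = f N A
      open NewMax σ (≤-trans (≤-reflexive (scanMax-Perm pσ (λ ()))) (n≤1+n N))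

  private
    reducedBounds : ∀ {π k} → InBl N k π → 1 ≤ k × k ≤ N
    reducedBounds ((p , _) , refl) = blockCount-Perm-pos p , blockCount-Perm-≤ p

  private
    -- ForwardSpec n k π × EndsWith R n k (f n π) with n ∸ k and f n π abstracted, for subst₂
    CaseSpec : (ℕ → ℕ → Set) → List ℕ → ℕ → List ℕ → Set
    CaseSpec R π d τ = (InL n d τ × ltrMask 0 τ ≡ ltrMask 0 π) × ∃ λ I → τ ≡ I ∷ʳ d × R (lastNonMax 0 0 I) (d ∸ 1)

  forward-caseC : ∀ A B {k} → InBl n k (A ++ n ∷ B ++ [ N ]) →
    ForwardSpec n k (A ++ n ∷ B ++ [ N ]) × EndsWith _≡_ n k (f n (A ++ n ∷ B ++ [ N ]))
  forward-caseC A B {k} ((p , a) , blocks≡k) = subst₂ (CaseSpec _≡_ (A ++ n ∷ B ++ [ N ])) (sym n∸k≡) (sym fπ≡)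
    ((inL , trans mask (trans (cong (_∷ʳ false) maskρ) (sym (ltrMask-caseC A B p)))) , map g ρ , refl , before≡c)
    where
      π″ = A ++ N ∷ B
      bl″ : InBl N k π″
      bl″ = reduce-caseC A B p a , trans (sym (blocks-caseC A B p)) blocks≡k
      ρ = f N π″
      spec = ih bl″
      maskρ = proj₂ spec
      c = N ∸ k
      c<N : c < N
      c<N = ∸-monoʳ-< (proj₁ (reducedBounds bl″)) (proj₂ (reducedBounds bl″))
      n∸k≡ : n ∸ k ≡ suc c
      n∸k≡ = +-∸-assoc 1 (proj₂ (reducedBounds bl″))
      open CaseC m c c<N
      open Lifted (lift ρ (proj₁ spec))
      fπ≡ : f n (A ++ n ∷ B ++ [ N ]) ≡ map g ρ ∷ʳ suc c
      fπ≡ = trans (f-caseC A B p blocks≡k) (trans (cong (λ d → cyc d n (ρ ∷ʳ n)) n∸k≡)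
        (trans (map-++ g ρ [ n ]) (cong (map g ρ ∷ʳ_) (cycVal-end (suc c) n (≤-trans c<N (n≤1+n N))))))

  record CaseBImage (A B : List ℕ) (k : ℕ) : Set where
    field
      X Z : List ℕ
      image≡ : f N (A ++ B) ≡ X ++ Z ∷ʳ (N ∸ k)
      |X|≡ : length X ≡ length A
      maskX : ltrMask 0 X ≡ ltrMask 0 A
      |Z|≡ : suc (length Z) ≡ length B
      Z<max : All (_< scanMax 0 X) (Z ∷ʳ (N ∸ k))

  caseBImage : ∀ A b B {k} → Perm n (A ++ n ∷ b ∷ B) → N ∈ A → ForwardSpec N k (A ++ b ∷ B) → CaseBImage A (b ∷ B) k
  caseBImage A b B {k} p N∈A (((pσ , _) , last≡) , maskσ) = record
    { X = X ; Z = Z ; image≡ = trans π′≡ (cong (X ++_) run≡) ; |X|≡ = |X′|≡ ; maskX = maskX′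
    ; |Z|≡ = trans (sym (length-∷ʳ Z c)) (trans (cong length (sym run≡)) (cong suc |Y|≡))
    ; Z<max = subst (All (_< scanMax 0 X)) run≡ Y<max }
    where
      open SplitAtMaxima (splitAtMaxima A (length B) pσ (λ ()) (trans maskσ (Run.ltrMask-run A (proj₂ (caseB-run A (b ∷ B) p N∈A)))))
        renaming (X′ to X)
      view = ∷ʳ-view (y ∷ Y) refl
      Z = proj₁ view
      c = N ∸ k
      run≡ : y ∷ Y ≡ Z ∷ʳ c
      run≡ = trans (proj₂ (proj₂ view)) (cong (Z ∷ʳ_) (begin
        proj₁ (proj₂ view)                       ≡⟨ lastOf-∷ʳ (lastNonMax 0 0 X) Z _ ⟨
        lastOf (lastNonMax 0 0 X) (Z ∷ʳ _)       ≡⟨ cong (lastOf (lastNonMax 0 0 X)) (proj₂ (proj₂ view)) ⟨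
        lastOf (lastNonMax 0 0 X) (y ∷ Y)        ≡⟨ Run.lastNonMax-run X Y<max ⟨
        lastNonMax 0 0 (X ++ y ∷ Y)              ≡⟨ cong (lastNonMax 0 0) π′≡ ⟨
        lastNonMax 0 0 (f N (A ++ b ∷ B))        ≡⟨ last≡ ⟩
        c                                        ∎))
        where open ≡-Reasoning

  forward-caseB : ∀ A b B {k} → N ∈ A → InBl n k (A ++ n ∷ b ∷ B) →
    ForwardSpec n k (A ++ n ∷ b ∷ B) × EndsWith _<_ n k (f n (A ++ n ∷ b ∷ B))
  forward-caseB A b B {k} N∈A ((p , a) , blocks≡k) = subst₂ (CaseSpec _<_ (A ++ n ∷ b ∷ B)) (sym n∸k≡) (sym fπ≡)
    ((inL , trans mask (trans (cong₂ (λ M r → M ++ true ∷ replicate r false) maskX |Z|≡) (sym maskπ)))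
    , map t X ++ n ∷ Z , sym (++-assoc (map t X) (n ∷ Z) [ suc c ]) , before<c)
    where
      bl′ : InBl N k (A ++ b ∷ B)
      bl′ = reduce-caseB A (b ∷ B) N∈A (p , a) , trans (sym (blocks-caseB A b B p N∈A)) blocks≡k
      σ = f N (A ++ b ∷ B)
      spec = ih bl′
      pσ = proj₁ (proj₁ (proj₁ spec))
      open CaseBImage (caseBImage A b B {k} p N∈A spec)
      c = N ∸ k
      1≤c : 1 ≤ c
      1≤c = proj₁ (Perm-∈⇒bounds pσ (subst (c ∈_) (sym image≡) (∈-++⁺ʳ X (∈-++⁺ʳ Z (here refl)))))
      c≤m : c ≤ m
      c≤m = subst (_≤ m) (proj₂ (proj₁ spec)) (lastNonMax-Perm pσ)
      open CaseB m c 1≤c c≤m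
      open Lifted (lift X Z Z<max (subst (InL N c) image≡ (proj₁ spec)))
      n∸k≡ : n ∸ k ≡ suc c
      n∸k≡ = +-∸-assoc 1 (proj₂ (reducedBounds bl′))
      fπ≡ : f n (A ++ n ∷ b ∷ B) ≡ map t X ++ n ∷ Z ∷ʳ suc c
      fπ≡ = begin
        f n (A ++ n ∷ b ∷ B)                                  ≡⟨ f-caseB A b B p N∈A blocks≡k ⟩
        transp (n ∸ k ∸ 1) (n ∸ k) (insertAt (length A) n σ)  ≡⟨ cong₂ (λ d W → transp (d ∸ 1) d (insertAt (length A) n W)) n∸k≡ image≡ ⟩
        map t (insertAt (length A) n (X ++ Z ∷ʳ c))           ≡⟨ cong (λ i → map t (insertAt i n (X ++ Z ∷ʳ c))) (sym |X|≡) ⟩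
        map t (insertAt (length X) n (X ++ Z ∷ʳ c))           ≡⟨ cong (map t) (insertAt-length X (Z ∷ʳ c) n) ⟩
        map t (X ++ n ∷ Z ∷ʳ c)                               ≡⟨ transp-caseB X Z Z<c ⟩
        map t X ++ n ∷ Z ∷ʳ suc c                             ∎
        where open ≡-Reasoning
      maskπ : ltrMask 0 (A ++ n ∷ b ∷ B) ≡ ltrMask 0 A ++ true ∷ replicate (length (b ∷ B)) false
      maskπ = MaxRun.ltrMask-maxRun A (AroundMax.scanMax≤n (aroundMax A (b ∷ B) p)) (AroundMax.B<n (aroundMax A (b ∷ B) p))

  forward : ∀ {k π} → InBl n k π → ForwardSpec n k π
  forward {π = π} bl@((p , a) , _) with shape π p a
  ... | caseA A refl       = forward-caseA A bl
  ... | caseB A b B refl N∈A = proj₁ (forward-caseB A b B N∈A bl)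
  ... | caseC A B refl     = proj₁ (forward-caseC A B bl)

f-forward : ∀ n {k π} → InBl n k π → ForwardSpec n k π
f-forward zero ((p , a) , refl) with Perm-zero p
... | refl = ((p , a) , refl) , refl
f-forward (suc zero) ((p , a) , refl) with Perm-one p
... | refl = ((p , a) , refl) , refl
f-forward (suc (suc m)) = Forward.forward m (f-forward (suc m))

module Injective (m : ℕ) (ih : ∀ {k π σ} → InBl (suc m) k π → InBl (suc m) k σ → f (suc m) π ≡ f (suc m) σ → π ≡ σ) where
  open Step m
  open Reduce m
  open Forward m (f-forward N)

  private
    -- case A ends with n; cases B and C with n ∸ k < n
    A≢BC : ∀ {k π I J} → InBl n k π → I ∷ʳ n ≡ J ∷ʳ (n ∸ k) → ⊥
    A≢BC ((p , _) , refl) eq = <-irrefl (sym (∷ʳ-injectiveʳ _ _ eq)) (∸-monoʳ-< (blockCount-Perm-pos p) (blockCount-Perm-≤ p))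

    B≢C : ∀ {k τ} → EndsWith _<_ n k τ → EndsWith _≡_ n k τ → ⊥
    B≢C (I , refl , I<) (J , eq , J≡) = <-irrefl (trans (cong (lastNonMax 0 0) (∷ʳ-injectiveˡ I J eq)) J≡) I<

  injective-caseA : ∀ A₁ A₂ {k} → InBl n k (A₁ ∷ʳ n) → InBl n k (A₂ ∷ʳ n) → f n (A₁ ∷ʳ n) ≡ f n (A₂ ∷ʳ n) → A₁ ∷ʳ n ≡ A₂ ∷ʳ n
  injective-caseA A₁ A₂ ((p₁ , a₁) , bl₁) ((p₂ , a₂) , bl₂) eq = cong (_∷ʳ n) (ih
    (reduce-caseA A₁ (p₁ , a₁) , cong pred (trans (sym (blocks-caseA A₁ p₁)) bl₁))
    (reduce-caseA A₂ (p₂ , a₂) , cong pred (trans (sym (blocks-caseA A₂ p₂)) bl₂))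
    (∷ʳ-injectiveˡ _ _ (trans (sym (f-caseA A₁ p₁)) (trans eq (f-caseA A₂ p₂)))))

  injective-caseB : ∀ A₁ b₁ B₁ A₂ b₂ B₂ {k} → N ∈ A₁ → N ∈ A₂ →
    InBl n k (A₁ ++ n ∷ b₁ ∷ B₁) → InBl n k (A₂ ++ n ∷ b₂ ∷ B₂) →
    f n (A₁ ++ n ∷ b₁ ∷ B₁) ≡ f n (A₂ ++ n ∷ b₂ ∷ B₂) → A₁ ++ n ∷ b₁ ∷ B₁ ≡ A₂ ++ n ∷ b₂ ∷ B₂
  injective-caseB A₁ b₁ B₁ A₂ b₂ B₂ {k} N∈A₁ N∈A₂ ((p₁ , a₁) , bl₁) ((p₂ , a₂) , bl₂) eq =
    cong₂ (λ X Y → X ++ n ∷ Y) (proj₁ parts) (proj₂ parts)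
    where
      bl′₁ : InBl N k (A₁ ++ b₁ ∷ B₁)
      bl′₁ = reduce-caseB A₁ (b₁ ∷ B₁) N∈A₁ (p₁ , a₁) , trans (sym (blocks-caseB A₁ b₁ B₁ p₁ N∈A₁)) bl₁
      bl′₂ : InBl N k (A₂ ++ b₂ ∷ B₂)
      bl′₂ = reduce-caseB A₂ (b₂ ∷ B₂) N∈A₂ (p₂ , a₂) , trans (sym (blocks-caseB A₂ b₂ B₂ p₂ N∈A₂)) bl₂
      σ₁ = f N (A₁ ++ b₁ ∷ B₁)
      σ₂ = f N (A₂ ++ b₂ ∷ B₂)
      pσ₁ = proj₁ (proj₁ (proj₁ (f-forward N bl′₁)))
      pσ₂ = proj₁ (proj₁ (proj₁ (f-forward N bl′₂)))
      inserted : insertAt (length A₁) n σ₁ ≡ insertAt (length A₂) n σ₂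
      inserted = map-injective-inverse {transpVal (n ∸ k ∸ 1) (n ∸ k)} {transpVal (n ∸ k ∸ 1) (n ∸ k)} (transpVal-involutive (n ∸ k ∸ 1) (n ∸ k))
        (trans (sym (f-caseB A₁ b₁ B₁ p₁ N∈A₁ bl₁)) (trans eq (f-caseB A₂ b₂ B₂ p₂ N∈A₂ bl₂)))
      n∉take : ∀ {i σ} → Perm N σ → n ∉ take i σ
      n∉take {i} {σ} p n∈ = 1+n≰n (Perm-∈⇒≤ p (∈-take n∈))
      halves = insert-injective (take (length A₁) σ₁) (take (length A₂) σ₂) (n∉take pσ₁) (n∉take pσ₂) inserted
      σ₁≡σ₂ : σ₁ ≡ σ₂
      σ₁≡σ₂ = trans (sym (take++drop≡id (length A₁) σ₁)) (trans (cong₂ _++_ (proj₁ halves) (proj₂ halves)) (take++drop≡id (length A₂) σ₂))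
      length-take-A : ∀ A b B {σ} → Perm N (A ++ b ∷ B) → Perm N σ → length (take (length A) σ) ≡ length A
      length-take-A A b B p p′ = trans (length-take (length A) _) (m≤n⇒m⊓n≡m
        (subst (length A ≤_) (trans (sym (length-++ A)) (trans (Perm⇒length p) (sym (Perm⇒length p′)))) (m≤m+n (length A) _)))
      parts = ++-cancel-≡length A₁ (b₁ ∷ B₁) A₂ (b₂ ∷ B₂) (ih bl′₁ bl′₂ σ₁≡σ₂)
        (trans (sym (length-take-A A₁ b₁ B₁ (proj₁ (proj₁ bl′₁)) pσ₁)) (trans (cong length (proj₁ halves)) (length-take-A A₂ b₂ B₂ (proj₁ (proj₁ bl′₂)) pσ₂)))

  injective-caseC : ∀ A₁ B₁ A₂ B₂ {k} → InBl n k (A₁ ++ n ∷ B₁ ++ [ N ]) → InBl n k (A₂ ++ n ∷ B₂ ++ [ N ]) →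
    f n (A₁ ++ n ∷ B₁ ++ [ N ]) ≡ f n (A₂ ++ n ∷ B₂ ++ [ N ]) → A₁ ++ n ∷ B₁ ++ [ N ] ≡ A₂ ++ n ∷ B₂ ++ [ N ]
  injective-caseC A₁ B₁ A₂ B₂ {k} ((p₁ , a₁) , bl₁) ((p₂ , a₂) , bl₂) eq =
    cong₂ (λ X Y → X ++ n ∷ Y ++ [ N ]) (proj₁ parts) (proj₂ parts)
    where
      rotated : f N (A₁ ++ N ∷ B₁) ∷ʳ n ≡ f N (A₂ ++ N ∷ B₂) ∷ʳ n
      rotated = map-injective-inverse {cycVal (n ∸ k) n} {cycInvVal (n ∸ k) n} (λ x → cycInvVal-cycVal (n ∸ k) n x (m∸n≤m n k))
        (trans (sym (f-caseC A₁ B₁ p₁ bl₁)) (trans eq (f-caseC A₂ B₂ p₂ bl₂)))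
      reduced≡ : A₁ ++ N ∷ B₁ ≡ A₂ ++ N ∷ B₂
      reduced≡ = ih (reduce-caseC A₁ B₁ p₁ a₁ , trans (sym (blocks-caseC A₁ B₁ p₁)) bl₁)
                    (reduce-caseC A₂ B₂ p₂ a₂ , trans (sym (blocks-caseC A₂ B₂ p₂)) bl₂)
                    (∷ʳ-injectiveˡ _ _ rotated)
      parts = insert-injective A₁ A₂ (CaseCFacts.N∉A (caseCFacts A₁ B₁ p₁)) (CaseCFacts.N∉A (caseCFacts A₂ B₂ p₂)) reduced≡

  injective : ∀ {k π σ} → InBl n k π → InBl n k σ → f n π ≡ f n σ → π ≡ σ
  injective {k} {π} {σ} bl₁@((p₁ , a₁) , _) bl₂@((p₂ , a₂) , _) eq with shape π p₁ a₁ | shape σ p₂ a₂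
  ... | caseA A₁ refl | caseA A₂ refl = injective-caseA A₁ A₂ bl₁ bl₂ eq
  ... | caseB A₁ b₁ B₁ refl N∈A₁ | caseB A₂ b₂ B₂ refl N∈A₂ = injective-caseB A₁ b₁ B₁ A₂ b₂ B₂ N∈A₁ N∈A₂ bl₁ bl₂ eq
  ... | caseC A₁ B₁ refl | caseC A₂ B₂ refl = injective-caseC A₁ B₁ A₂ B₂ bl₁ bl₂ eq
  ... | caseA A₁ refl | caseB A₂ b₂ B₂ refl N∈A₂ =
    let I , ends , _ = proj₂ (forward-caseB A₂ b₂ B₂ N∈A₂ bl₂) in ⊥-elim (A≢BC bl₂ (trans (sym (f-caseA A₁ p₁)) (trans eq ends)))
  ... | caseA A₁ refl | caseC A₂ B₂ refl =
    let I , ends , _ = proj₂ (forward-caseC A₂ B₂ bl₂) in ⊥-elim (A≢BC bl₂ (trans (sym (f-caseA A₁ p₁)) (trans eq ends)))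
  ... | caseB A₁ b₁ B₁ refl N∈A₁ | caseA A₂ refl =
    let I , ends , _ = proj₂ (forward-caseB A₁ b₁ B₁ N∈A₁ bl₁) in ⊥-elim (A≢BC bl₁ (trans (sym (f-caseA A₂ p₂)) (trans (sym eq) ends)))
  ... | caseC A₁ B₁ refl | caseA A₂ refl =
    let I , ends , _ = proj₂ (forward-caseC A₁ B₁ bl₁) in ⊥-elim (A≢BC bl₁ (trans (sym (f-caseA A₂ p₂)) (trans (sym eq) ends)))
  ... | caseB A₁ b₁ B₁ refl N∈A₁ | caseC A₂ B₂ refl =
    ⊥-elim (B≢C {k} (proj₂ (forward-caseB A₁ b₁ B₁ N∈A₁ bl₁)) (subst (EndsWith _≡_ n k) (sym eq) (proj₂ (forward-caseC A₂ B₂ bl₂))))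
  ... | caseC A₁ B₁ refl | caseB A₂ b₂ B₂ refl N∈A₂ =
    ⊥-elim (B≢C {k} (proj₂ (forward-caseB A₂ b₂ B₂ N∈A₂ bl₂)) (subst (EndsWith _≡_ n k) eq (proj₂ (forward-caseC A₁ B₁ bl₁))))

f-injective : ∀ n {k π σ} → InBl n k π → InBl n k σ → f n π ≡ f n σ → π ≡ σ
f-injective zero ((p₁ , _) , _) ((p₂ , _) , _) _ = trans (Perm-zero p₁) (sym (Perm-zero p₂))
f-injective (suc zero) ((p₁ , _) , _) ((p₂ , _) , _) _ = trans (Perm-one p₁) (sym (Perm-one p₂))
f-injective (suc (suc m)) = Injective.injective m (f-injective (suc m))

SurjSpec : ℕ → ℕ → List ℕ → Set
SurjSpec n k τ = Σ (List ℕ) λ π → InBl n k π × f n π ≡ τ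

module Surjective (m : ℕ) (ih : ∀ {k τ} → k ≤ suc m → InL (suc m) (suc m ∸ k) τ → SurjSpec (suc m) k τ) where
  open Step m
  open Reduce m

  surjective-caseA : ∀ I {k} → k ≤ n → InL n (n ∸ k) (I ∷ʳ n) → SurjSpec n k (I ∷ʳ n)
  -- k = 0 would make n the last non-maximum of τ.
  surjective-caseA I {zero} _ ((p , a) , last≡n) =
    ⊥-elim (1+n≰n (≤-trans (≤-reflexive (sym (trans (sym lastNonMax-newMax) last≡n))) (≤-trans (lastNonMax-Perm (Perm-∷ʳ⁻ I p)) (n≤1+n m))))
    where open NewMax I (AroundMax.scanMax≤n (aroundMax I [] p))
  surjective-caseA I {suc k} k<n ((p , a) , last≡) with ih (s≤s⁻¹ k<n) (reduce-caseA I (p , a) , trans (sym lastNonMax-newMax) last≡)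
    where open NewMax I (AroundMax.scanMax≤n (aroundMax I [] p))
  ... | π₀ , (av₀ , blocks₀) , f≡ = π₀ ∷ʳ n , (av , trans (blocks-caseA π₀ (proj₁ av)) (cong suc blocks₀)) , trans (f-caseA π₀ (proj₁ av)) (cong (_∷ʳ n) f≡)
    where av = extend-caseA π₀ av₀

  surjective-caseC : ∀ I c {k} → k ≤ N → N ∸ k ≡ c → c < N → InL n (suc c) (I ∷ʳ suc c) → lastNonMax 0 0 I ≡ c →
    SurjSpec n k (I ∷ʳ suc c)
  surjective-caseC I c {k} k≤N c≡ c<N inL last≡c with ih k≤N (subst (λ d → InL N d (map h I)) (sym c≡) (lower I inL last≡c))
    where open CaseC m c c<N
  ... | π″ , (av″ , blocks″) , f≡ with ∈-∃++ (Perm-∋max (proj₁ av″) (λ ()))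
  ... | A , B , refl = A ++ n ∷ B ++ [ N ] , (av , blocks≡k) , fπ≡
    where
      open CaseC m c c<N
      av = extend-caseC A B av″
      blocks≡k = trans (blocks-caseC A B (proj₁ av)) blocks″
      fπ≡ : f n (A ++ n ∷ B ++ [ N ]) ≡ I ∷ʳ suc c
      fπ≡ = begin
        f n (A ++ n ∷ B ++ [ N ])            ≡⟨ f-caseC A B (proj₁ av) blocks≡k ⟩
        cyc (n ∸ k) n (f N (A ++ N ∷ B) ∷ʳ n) ≡⟨ cong₂ (λ d ρ → cyc d n (ρ ∷ʳ n)) (trans (+-∸-assoc 1 k≤N) (cong suc c≡)) f≡ ⟩
        map g (map h I ∷ʳ n)                 ≡⟨ map-++ g (map h I) [ n ] ⟩
        map g (map h I) ∷ʳ g n               ≡⟨ cong₂ _∷ʳ_ (map-inverse (λ x → cycVal-cycInvVal (suc c) n x (≤-trans c<N (n≤1+n N))) I)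
                                                           (cycVal-end (suc c) n (≤-trans c<N (n≤1+n N))) ⟩
        I ∷ʳ suc c                           ∎
        where open ≡-Reasoning

  surjective-caseB : ∀ X Z c {k} → k ≤ N → N ∸ k ≡ c → 1 ≤ c → c ≤ m →
    InL n (suc c) (X ++ n ∷ Z ∷ʳ suc c) → lastNonMax 0 0 (X ++ n ∷ Z) < c → SurjSpec n k (X ++ n ∷ Z ∷ʳ suc c)
  surjective-caseB X Z c {k} k≤N c≡ 1≤c c≤m inLτ before<c with lower X Z inLτ before<c
    where open CaseB m c 1≤c c≤m
  ... | lowered with ih k≤N (subst (λ d → InL N d (map t X ++ Z ∷ʳ c)) (sym c≡) (Lowered.inL lowered))
    where open CaseB m c 1≤c c≤m
  ... | π′ , bl′ , f≡ = X′ ++ n ∷ y ∷ Y , (av , blocks≡k) , fπ≡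
    where
      open CaseB m c 1≤c c≤m
      open Lowered lowered
      σ = map t X ++ Z ∷ʳ c
      maskπ′ : ltrMask 0 π′ ≡ ltrMask 0 (map t X) ++ replicate (length (Z ∷ʳ c)) false
      maskπ′ = trans (sym (proj₂ (f-forward N bl′))) (trans (cong (ltrMask 0) f≡) (Run.ltrMask-run (map t X) Z<max))
      open SplitAtMaxima (splitAtMaxima (map t X) (length Z) (proj₁ (proj₁ bl′)) (λ ()) (trans maskπ′ (cong (λ r → ltrMask 0 (map t X) ++ replicate r false) (length-∷ʳ Z c))))
      av = extend-caseB X′ (y ∷ Y) Y<max (subst (Avoiding N) π′≡ (proj₁ bl′))
      blocks≡k : blockCount 1 0 (X′ ++ n ∷ y ∷ Y) ≡ k
      blocks≡k = trans (blocks-caseB X′ y Y (proj₁ av) N∈X′) (trans (cong (blockCount 1 0) (sym π′≡)) (proj₂ bl′))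
      fπ≡ : f n (X′ ++ n ∷ y ∷ Y) ≡ X ++ n ∷ Z ∷ʳ suc c
      fπ≡ = begin
        f n (X′ ++ n ∷ y ∷ Y)
          ≡⟨ f-caseB X′ y Y (proj₁ av) N∈X′ blocks≡k ⟩
        transp (n ∸ k ∸ 1) (n ∸ k) (insertAt (length X′) n (f N (X′ ++ y ∷ Y)))
          ≡⟨ cong₂ (λ d W → transp (d ∸ 1) d W) (trans (+-∸-assoc 1 k≤N) (cong suc c≡))
                   (cong₂ (λ i ρ → insertAt i n ρ) |X′|≡ (trans (cong (f N) (sym π′≡)) f≡)) ⟩
        map t (insertAt (length (map t X)) n σ)
          ≡⟨ cong (map t) (insertAt-length (map t X) (Z ∷ʳ c) n) ⟩
        map t (map t X ++ n ∷ Z ∷ʳ c)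
          ≡⟨ transp-caseB (map t X) Z Z<c ⟩
        map t (map t X) ++ n ∷ Z ∷ʳ suc c
          ≡⟨ cong (_++ n ∷ Z ∷ʳ suc c) (map-inverse (transpVal-involutive c (suc c)) X) ⟩
        X ++ n ∷ Z ∷ʳ suc c ∎
        where open ≡-Reasoning

  -- A last letter c + 1 < n is the last non-maximum, so c + 1 = n ∸ k; the last
  -- non-maximum before it is below c (case B) or equal to c (case C).
  private
    lastLetter : ∀ I c {k} → k ≤ n → InL n (n ∸ k) (I ∷ʳ suc c) → suc c < n →
      k ≤ N × N ∸ k ≡ c × lastNonMax 0 0 I ≤ c × n ∈ I
    lastLetter I c {k} k≤n ((p , a) , last≡) (s≤s c<N) = k≤N , suc-injective (trans (sym (+-∸-assoc 1 k≤N)) n∸k≡) , before≤c , n∈I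
      where
        n∈I : n ∈ I
        n∈I = Sum.[ id , (λ { (here n≡) → ⊥-elim (<-irrefl (sym n≡) (s≤s c<N)) }) ]′ (∈-++⁻ I (Perm-∋max p (λ ())))
        open Run I (<-≤-trans (s≤s c<N) (∈⇒≤scanMax 0 I n∈I) ∷ [])
        n∸k≡ : n ∸ k ≡ suc c
        n∸k≡ = trans (sym last≡) lastNonMax-run
        k≤N : k ≤ N
        k≤N = s≤s⁻¹ (≤∧≢⇒< k≤n (λ { refl → 1+n≢0 (trans (sym n∸k≡) (n∸n≡0 n)) }))
        x∉I : suc c ∉ I
        x∉I x∈I = proj₂ (proj₂ (Distinct-++⁻ I [ suc c ] (Perm⇒Distinct p))) x∈I (here refl)
        before≤c : lastNonMax 0 0 I ≤ c
        before≤c = s≤s⁻¹ (≤∧≢⇒< (proj₁ (proj₂ (Avoids321-run⁻ a))) λ before≡x →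
          Sum.[ (λ before≡0 → 1+n≢0 (trans (sym before≡x) before≡0)) , (λ (∈I , _) → x∉I (subst (_∈ I) before≡x ∈I)) ]′ (lastNonMax-initial⊎∈ 0 0 I))

  surjective-caseBC : ∀ I c {k} → k ≤ n → InL n (n ∸ k) (I ∷ʳ suc c) → suc c < n → SurjSpec n k (I ∷ʳ suc c)
  surjective-caseBC I c {k} k≤n inLτ x<n with lastLetter I c k≤n inLτ x<n
  ... | k≤N , c≡ , before≤c , n∈I with m≤n⇒m<n∨m≡n before≤c
  ...   | inj₂ before≡c = surjective-caseC I c k≤N c≡ (s≤s⁻¹ x<n) inL′ before≡c
    where inL′ = subst (λ d → InL n d (I ∷ʳ suc c)) (trans (+-∸-assoc 1 k≤N) (cong suc c≡)) inLτ
  ...   | inj₁ before<c with ∈-∃++ n∈I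
  ...     | X , Z , refl = subst (SurjSpec n k) (sym assoc)
              (surjective-caseB X Z c k≤N c≡ (≤-<-trans z≤n before<c) (s≤s⁻¹ (s≤s⁻¹ x<n)) (subst (InL n (suc c)) assoc inL′) before<c)
    where
      assoc = ++-assoc X (n ∷ Z) [ suc c ]
      inL′ = subst (λ d → InL n d ((X ++ n ∷ Z) ∷ʳ suc c)) (trans (+-∸-assoc 1 k≤N) (cong suc c≡)) inLτ

  surjective : ∀ {k τ} → k ≤ n → InL n (n ∸ k) τ → SurjSpec n k τ
  surjective {k} {τ} k≤n inLτ with ∷ʳ-view τ (Perm⇒length (proj₁ (proj₁ inLτ)))
  ... | I , x , refl with x ≟ n | Perm-∈⇒bounds (proj₁ (proj₁ inLτ)) (∈-++⁺ʳ I (here refl))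
  ...   | yes refl | _ = surjective-caseA I k≤n inLτ
  ...   | no x≢n | s≤s _ , x≤n = surjective-caseBC I _ k≤n inLτ (≤∧≢⇒< x≤n x≢n)

f-surjective : ∀ n {k τ} → k ≤ n → InL n (n ∸ k) τ → SurjSpec n k τ
f-surjective zero {τ = τ} z≤n ((p , a) , _) with Perm-zero p
... | refl = [] , ((p , a) , refl) , refl
f-surjective (suc zero) {zero} _ ((p , _) , last≡) with Perm-one p
... | refl = ⊥-elim (1+n≢0 (sym last≡))
f-surjective (suc zero) {suc zero} _ ((p , a) , _) with Perm-one p
... | refl = [ 1 ] , ((p , a) , refl) , refl
f-surjective (suc zero) {suc (suc _)} (s≤s ()) _
f-surjective (suc (suc m)) = Surjective.surjective m (f-surjective (suc m))

Bl⇒InBl : ∀ {n k π} → Bl n k π → InBl n k π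
Bl⇒InBl {π = π} ((isPerm , avoids) , bl≡k) = (IsPerm⇒Perm isPerm , Avoids321⇒Avoids321From π avoids) , trans (sym (bl≡blockCount π)) bl≡k

InBl⇒Bl : ∀ {n k π} → InBl n k π → Bl n k π
InBl⇒Bl {π = π} ((p , a) , blocks≡k) = (Perm⇒IsPerm p , Avoids321From⇒Avoids321 π a) , trans (bl≡blockCount π) blocks≡k

L⇒InL : ∀ {n c τ} → L n c τ → InL n c τ
L⇒InL {n} {τ = τ} ((isPerm , avoids) , ldes≡c) = (p , a) , trans (sym (ldes-inverse≡lastNonMax n τ p a)) ldes≡c
  where p = IsPerm⇒Perm isPerm
        a = Avoids321⇒Avoids321From τ avoids

InL⇒L : ∀ {n c τ} → InL n c τ → L n c τ
InL⇒L {n} {τ = τ} ((p , a) , last≡c) = (Perm⇒IsPerm p , Avoids321From⇒Avoids321 τ a) , trans (ldes-inverse≡lastNonMax n τ p a) last≡c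

theorem4p5 : (n k : ℕ) → 1 ≤ k → k ≤ n →
    ((π : List ℕ) → Bl n k π → L n (n ∸ k) (f n π) × Ltr (f n π) ≡ Ltr π)
    × ((π σ : List ℕ) → Bl n k π → Bl n k σ → f n π ≡ f n σ → π ≡ σ)
    × ((τ : List ℕ) → L n (n ∸ k) τ → Σ (List ℕ) (λ π → Bl n k π × f n π ≡ τ))
theorem4p5 n k _ k≤n = maps-into , injective , surjective
  where
    maps-into : (π : List ℕ) → Bl n k π → L n (n ∸ k) (f n π) × Ltr (f n π) ≡ Ltr π
    maps-into π bl with f-forward n (Bl⇒InBl bl)
    ... | inL , mask≡ = InL⇒L inL , Ltr-cong (f n π) π mask≡
    injective : (π σ : List ℕ) → Bl n k π → Bl n k σ → f n π ≡ f n σ → π ≡ σ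
    injective π σ bl₁ bl₂ = f-injective n (Bl⇒InBl bl₁) (Bl⇒InBl bl₂)
    surjective : (τ : List ℕ) → L n (n ∸ k) τ → Σ (List ℕ) (λ π → Bl n k π × f n π ≡ τ)
    surjective τ l with f-surjective n k≤n (L⇒InL l)
    ... | π , bl , f≡τ = π , InBl⇒Bl bl , f≡τ
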